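{- Let $n\ge 2$ and let $O=\{b_1,\dots,b_m\}$ ($0\le m\le 2n-1$) be an order ideal of the type $(B_n,1)$ poset $Q$ described in the context. An $\oplus$-diagram $D$ of shape $O$ is a $\Gamma$-diagram if and only if for every $k$ with $n<k\le m$ and $D(b_k)=0$, it is not the case that both $D(b_{k-1})=+$ and $D(b_{2n-k+1})=+$ (here $b_{k-1}$ is the box immediately to the left of $b_k$ and $b_{2n-k+1}$ is its conjugate; for $k=n+1$ both are the middle box $b_n$).
   Context: $W$: Weyl group of type $B_n$, simple reflections $s_1,\dots,s_n$ ($s_is_{i+1}$ of order 3 for $i\le n-2$, $s_{n-1}s_n$ of order 4, other pairs commute), Bruhat order $<$. $Q$ is a chain (a single row) $b_1<b_2<\dots<b_{2n-1}$ with labels $s_{b_k}=s_k$ for $k\le n$ and $s_{b_k}=s_{2n-k}$ for $k\ge n$; $b_n$ is the middle box and $b_k$, $b_{2n-k}$ are called conjugate. Order ideals are the initial segments $\{b_1,\dots,b_m\}$. An $\oplus$-diagram of shape $O$ is a map $D:O\to\{0,+\}$. Write $s_{i_t}:=s_{b_{m+1-t}}$ so that $s_{i_1}\cdots s_{i_m}=s_{b_m}\cdots s_{b_1}$, and let $t_t=s_{i_t}$ if $D(b_{m+1-t})=0$, $t_t=1$ if $D(b_{m+1-t})=+$; $v_{(0)}=1$, $v_{(k)}=t_1\cdots t_k$. $D$ is a $\Gamma$-diagram if $v_{(k-1)}<v_{(k-1)}s_{i_k}$ for $k=1,\dots,m$. -}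

module Defs where

open import Data.Nat using (ℕ; zero; suc; _+_; _*_; _∸_; _≤_; _<_; _≤?_; _<?_; _≟_)
open import Data.Integer using (ℤ; +_; -_)
open import Data.List using (List; []; _∷_; _++_; reverse; map; foldl; length; upTo)
open import Data.List.Relation.Unary.All using (All)
open import Data.Vec using (Vec; []; _∷_)
open import Data.Product using (Σ; _×_; _,_)
open import Relation.Binary.PropositionalEquality using (_≡_)
open import Relation.Nullary using (yes; no)

-- The Weyl group W(B_n), realised faithfully as signed permutations of
-- {1,…,n} in one-line notation: an element w is the list
-- (w(1), …, w(n)) of nonzero integers.  Simple reflections act on the
-- right: w·s_i (1 ≤ i < n) swaps positions i and i+1, and w·s_n negates
-- position n.  (s_i s_{i+1} has order 3, s_{n-1} s_n order 4, other
-- pairs commute.)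

idn : ℕ → List ℤ
idn n = map (λ i → + suc i) (upTo n)

swapAt : ℕ → List ℤ → List ℤ
swapAt (suc zero) (a ∷ b ∷ xs) = b ∷ a ∷ xs
swapAt (suc (suc i)) (x ∷ xs) = x ∷ swapAt (suc i) xs
swapAt _ xs = xs

negAt : ℕ → List ℤ → List ℤ
negAt (suc zero) (x ∷ xs) = (- x) ∷ xs
negAt (suc (suc i)) (x ∷ xs) = x ∷ negAt (suc i) xs
negAt _ xs = xs

-- right multiplication by the simple reflection s_i in W(B_n)
-- (indices outside 1..n act trivially; they never occur below)
mulGen : ℕ → List ℤ → ℕ → List ℤ
mulGen n w i with 1 ≤? i | i <? n | i ≟ n
... | yes _ | yes _ | _     = swapAt i w
... | yes _ | no _  | yes _ = negAt n w
... | _     | _     | _     = w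

act : ℕ → List ℤ → List ℕ → List ℤ
act n w ws = foldl (mulGen n) w ws

eval : ℕ → List ℕ → List ℤ
eval n ws = act n (idn n) ws

ValidWord : ℕ → List ℕ → Set
ValidWord n ws = All (λ i → 1 ≤ i × i ≤ n) ws

IsLength : ℕ → List ℤ → ℕ → Set
IsLength n w k =
  Σ (List ℕ) (λ ws → ValidWord n ws × length ws ≡ k × eval n ws ≡ w)
  × (∀ ws → ValidWord n ws → eval n ws ≡ w → k ≤ length ws)

-- one Bruhat step: w' = w t with t = u s u⁻¹ a reflection and ℓ(w) < ℓ(w')
BruhatStep : ℕ → List ℤ → List ℤ → Set
BruhatStep n w w' =
  Σ (List ℕ) (λ u → Σ ℕ (λ s →
     ValidWord n u × (1 ≤ s × s ≤ n)
     × w' ≡ act n w (u ++ s ∷ reverse u)))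
  × Σ ℕ (λ k → Σ ℕ (λ k' → IsLength n w k × IsLength n w' k' × k < k'))

data BruhatLt (n : ℕ) : List ℤ → List ℤ → Set where
  step  : ∀ {w w'} → BruhatStep n w w' → BruhatLt n w w'
  trans : ∀ {w w' w''} → BruhatStep n w w' → BruhatLt n w' w'' → BruhatLt n w w''

data Sign : Set where
  zer : Sign
  pls : Sign

-- index of the simple reflection labelling box b_k (1 ≤ k ≤ 2n-1)
label : ℕ → ℕ → ℕ
label n k with k ≤? n
... | yes _ = k
... | no _  = 2 * n ∸ k

-- an ⊕-diagram of shape {b_1,…,b_m} is a vector D of length m, with
-- D(b_k) = val D k for 1 ≤ k ≤ m (the default for other k is never used)
val : ∀ {m} → Vec Sign m → ℕ → Sign
val [] _ = pls
val (x ∷ xs) zero = pls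
val (x ∷ xs) (suc zero) = x
val (x ∷ xs) (suc (suc k)) = val xs (suc k)

iLetter : ℕ → ℕ → ℕ → ℕ
iLetter n m t = label n (m + 1 ∸ t)

-- the word t_1 ⋯ t_k representing v_(k): t_t = s_{i_t} if D(b_{m+1-t}) = 0,
-- and t_t = 1 if D(b_{m+1-t}) = +
vWord : ∀ {m} → ℕ → Vec Sign m → ℕ → List ℕ
vWord {m} n D zero = []
vWord {m} n D (suc k) with val D (m ∸ k)
... | zer = vWord n D k ++ (label n (m ∸ k) ∷ [])
... | pls = vWord n D k

IsΓDiagram : ∀ {m} → ℕ → Vec Sign m → Set
IsΓDiagram {m} n D =
  ∀ k → 1 ≤ k → k ≤ m →
    BruhatLt n (eval n (vWord n D (k ∸ 1)))
               (act n (eval n (vWord n D (k ∸ 1))) (iLetter n m k ∷ []))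

-- The inversion statistic of Inversions is 0 at the identity, grows by at most one under each
-- simple reflection and by exactly one at an ascent, so a word attaining it is reduced.
-- If D avoids the pattern, each letter s_{i_k} is an ascent of v_(k-1).  The boxes b_c with
-- c > n, read first, build an unsigned permutation π, a product of disjoint cycles whose only
-- inversions close a run of used letters; the middle box negates a positive entry.  When a box
-- b_c with c < n is read, position c + 1 holds π e for the first box b_e = + above it (or a
-- negative entry), and a descent π c > π e means that s_c, …, s_{e-1} are used, which is the
-- forbidden pattern at b_{2n+1-e}.  So every v_(k-1) s_{i_k} is reduced and one longer than
-- v_(k-1): a Bruhat step.  Conversely, switching a forbidden zero b_k to + removes a letter s_j
-- (j = 2n ∸ k) that commutes with everything read between b_k and b_j, so the element reached
-- just before b_j already ends in s_j and multiplying it by s_j shortens it.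

module Submission where

open import Defs renaming (trans to step-then)
open import Data.Nat using (ℕ; zero; suc; _+_; _*_; _∸_; _≤_; _<_; z≤n; s≤s; _≟_; _≤?_; _<?_)
open import Data.Nat.Properties
open import Data.Nat.Tactic.RingSolver using (solve-∀)
open import Algebra.Properties.CommutativeSemigroup +-commutativeSemigroup using (x∙yz≈y∙xz)
open import Data.Integer as ℤ using (ℤ; +_; -[1+_])
open import Data.List using (List; []; _∷_; _++_; length; map; applyUpTo)
open import Data.List.Properties using (foldl-++; length-++)
open import Data.List.Relation.Unary.All using (All; []; _∷_)
open import Data.List.Relation.Unary.All.Properties using (++⁺)
open import Data.Vec using (Vec; []; _∷_)
open import Data.Product using (∃-syntax; _×_; _,_; proj₁; proj₂; uncurry)
open import Data.Empty using (⊥-elim)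
open import Data.Sum using (inj₁; inj₂)
open import Relation.Binary.PropositionalEquality
open import Relation.Nullary using (yes; no; ¬_)
open import Relation.Binary using (tri<; tri≈; tri>)
open import Function.Bundles using (_⇔_; mk⇔)
open import Function using (_∘_; id; case_of_)

⟦_>_⟧ : ℕ → ℕ → ℕ
⟦ zero  > _     ⟧ = 0
⟦ suc a > zero  ⟧ = 1
⟦ suc a > suc b ⟧ = ⟦ a > b ⟧

⟦>⟧-≤ : ∀ {a b} → a ≤ b → ⟦ a > b ⟧ ≡ 0
⟦>⟧-≤ z≤n     = refl
⟦>⟧-≤ (s≤s p) = ⟦>⟧-≤ p

⟦>⟧-< : ∀ {a b} → b < a → ⟦ a > b ⟧ ≡ 1
⟦>⟧-< {suc a} {zero}  _       = refl
⟦>⟧-< {suc a} {suc b} (s≤s p) = ⟦>⟧-< p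

⟦>⟧≤1 : ∀ a b → ⟦ a > b ⟧ ≤ 1
⟦>⟧≤1 zero    b       = z≤n
⟦>⟧≤1 (suc a) zero    = ≤-refl
⟦>⟧≤1 (suc a) (suc b) = ⟦>⟧≤1 a b

⟦>⟧-+-cancelˡ : ∀ c a b → ⟦ c + a > c + b ⟧ ≡ ⟦ a > b ⟧
⟦>⟧-+-cancelˡ zero    a b = refl
⟦>⟧-+-cancelˡ (suc c) a b = ⟦>⟧-+-cancelˡ c a b

⟦_<0⟧ : ℤ → ℕ
⟦ + _      <0⟧ = 0
⟦ -[1+ _ ] <0⟧ = 1

⟦<0⟧≤1 : ∀ x → ⟦ x <0⟧ ≤ 1
⟦<0⟧≤1 (+ _)      = z≤n
⟦<0⟧≤1 -[1+ _ ]   = ≤-refl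

suc-∸1 : ∀ {a} → 1 ≤ a → suc (a ∸ 1) ≡ a
suc-∸1 (s≤s _) = refl

2*n≡n+n : ∀ n → 2 * n ≡ n + n
2*n≡n+n n = cong (_+_ n) (+-identityʳ n)

-- 1-based lookup; the junk value +0 is returned at position 0 and beyond the end.
entry : List ℤ → ℕ → ℤ
entry []       _             = + 0
entry (x ∷ xs) zero          = + 0
entry (x ∷ xs) (suc zero)    = x
entry (x ∷ xs) (suc (suc i)) = entry xs (suc i)

transpose : ℕ → ℕ → ℕ
transpose zero    zero          = 1
transpose zero    (suc zero)    = 0
transpose zero    (suc (suc x)) = suc (suc x)
transpose (suc l) zero          = zero
transpose (suc l) (suc x)       = suc (transpose l x)

transpose-self : ∀ l → transpose l l ≡ suc l
transpose-self zero    = refl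
transpose-self (suc l) = cong suc (transpose-self l)

transpose-suc : ∀ l → transpose l (suc l) ≡ l
transpose-suc zero    = refl
transpose-suc (suc l) = cong suc (transpose-suc l)

transpose-other : ∀ l x → x ≢ l → x ≢ suc l → transpose l x ≡ x
transpose-other zero    zero          p q = ⊥-elim (p refl)
transpose-other zero    (suc zero)    p q = ⊥-elim (q refl)
transpose-other zero    (suc (suc x)) p q = refl
transpose-other (suc l) zero          p q = refl
transpose-other (suc l) (suc x)       p q = cong suc (transpose-other l x (p ∘ cong suc) (q ∘ cong suc))

transpose-fix-above : ∀ {l x} → suc l < x → transpose l x ≡ x
transpose-fix-above {zero}  {suc zero}    (s≤s ())
transpose-fix-above {zero}  {suc (suc x)} _       = refl
transpose-fix-above {suc l} {suc x}       (s≤s p) = cong suc (transpose-fix-above p)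

transpose-fix-below : ∀ {l x} → x < l → transpose l x ≡ x
transpose-fix-below {suc l} {zero}  _       = refl
transpose-fix-below {suc l} {suc x} (s≤s p) = cong suc (transpose-fix-below p)

transpose-≤ : ∀ {l x B} → x ≤ B → suc l ≤ B → transpose l x ≤ B
transpose-≤ {zero}  {zero}          _       q       = q
transpose-≤ {zero}  {suc zero}      _       _       = z≤n
transpose-≤ {zero}  {suc (suc x)}   p       _       = p
transpose-≤ {suc l} {zero}          _       _       = z≤n
transpose-≤ {suc l} {suc x}         (s≤s p) (s≤s q) = s≤s (transpose-≤ p q)

data Around (l : ℕ) : ℕ → Set where
  here      : Around l l
  next      : Around l (suc l)
  elsewhere : ∀ {x} → x ≢ l → x ≢ suc l → Around l x

around : ∀ l x → Around l x
around l x with x ≟ l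
... | yes refl = here
... | no x≢l with x ≟ suc l
...   | yes refl  = next
...   | no x≢1+l  = elsewhere x≢l x≢1+l

entry-swapAt : ∀ i w x → suc (suc i) ≤ length w →
  entry (swapAt (suc i) w) x ≡ entry w (transpose (suc i) x)
entry-swapAt zero    (a ∷ [])    x                   (s≤s ())
entry-swapAt zero    (a ∷ b ∷ w) zero                _       = refl
entry-swapAt zero    (a ∷ b ∷ w) (suc zero)          _       = refl
entry-swapAt zero    (a ∷ b ∷ w) (suc (suc zero))    _       = refl
entry-swapAt zero    (a ∷ b ∷ w) (suc (suc (suc x))) _       = refl
entry-swapAt (suc i) (a ∷ w)     zero                _       = refl
entry-swapAt (suc i) (a ∷ w)     (suc zero)          _       = refl
entry-swapAt (suc i) (a ∷ w)     (suc (suc x))       (s≤s p) = entry-swapAt i w (suc x) p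

entry-negAt-self : ∀ i w → entry (negAt (suc i) w) (suc i) ≡ ℤ.- entry w (suc i)
entry-negAt-self zero    []      = refl
entry-negAt-self zero    (x ∷ w) = refl
entry-negAt-self (suc i) []      = refl
entry-negAt-self (suc i) (x ∷ w) = entry-negAt-self i w

entry-negAt-other : ∀ i w x → x ≢ suc i → entry (negAt (suc i) w) x ≡ entry w x
entry-negAt-other zero    []      x             _ = refl
entry-negAt-other (suc i) []      x             _ = refl
entry-negAt-other zero    (a ∷ w) zero          _ = refl
entry-negAt-other (suc i) (a ∷ w) zero          _ = refl
entry-negAt-other zero    (a ∷ w) (suc zero)    p = ⊥-elim (p refl)
entry-negAt-other zero    (a ∷ w) (suc (suc x)) _ = refl
entry-negAt-other (suc i) (a ∷ w) (suc zero)    _ = refl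
entry-negAt-other (suc i) (a ∷ w) (suc (suc x)) p = entry-negAt-other i w (suc x) (p ∘ cong suc)

All-entry : ∀ {P : ℤ → Set} {w i} → All P w → 1 ≤ i → i ≤ length w → P (entry w i)
All-entry {w = x ∷ w} {suc zero}    (px ∷ _)  _ _       = px
All-entry {w = x ∷ w} {suc (suc i)} (_ ∷ pxs) _ (s≤s p) = All-entry pxs (s≤s z≤n) p

length-swapAt : ∀ i w → length (swapAt i w) ≡ length w
length-swapAt zero          w           = refl
length-swapAt (suc zero)    []          = refl
length-swapAt (suc zero)    (x ∷ [])    = refl
length-swapAt (suc zero)    (x ∷ y ∷ w) = refl
length-swapAt (suc (suc i)) []          = refl
length-swapAt (suc (suc i)) (x ∷ w)     = cong suc (length-swapAt (suc i) w)

length-negAt : ∀ i w → length (negAt i w) ≡ length w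
length-negAt zero          w       = refl
length-negAt (suc zero)    []      = refl
length-negAt (suc zero)    (x ∷ w) = refl
length-negAt (suc (suc i)) []      = refl
length-negAt (suc (suc i)) (x ∷ w) = cong suc (length-negAt (suc i) w)

All-swapAt : ∀ {P : ℤ → Set} i {w} → All P w → All P (swapAt i w)
All-swapAt zero          ps                = ps
All-swapAt (suc zero)    []                = []
All-swapAt (suc zero)    (p ∷ [])          = p ∷ []
All-swapAt (suc zero)    (p ∷ q ∷ ps)      = q ∷ p ∷ ps
All-swapAt (suc (suc i)) []                = []
All-swapAt (suc (suc i)) (p ∷ ps)          = p ∷ All-swapAt (suc i) ps

All-negAt : ∀ {P : ℤ → Set} → (∀ {x} → P x → P (ℤ.- x)) → ∀ i {w} → All P w → All P (negAt i w)
All-negAt neg zero          ps       = ps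
All-negAt neg (suc zero)    []       = []
All-negAt neg (suc zero)    (p ∷ ps) = neg p ∷ ps
All-negAt neg (suc (suc i)) []       = []
All-negAt neg (suc (suc i)) (p ∷ ps) = p ∷ All-negAt neg (suc i) ps

swapAt-involutive : ∀ i w → swapAt i (swapAt i w) ≡ w
swapAt-involutive zero          w           = refl
swapAt-involutive (suc zero)    []          = refl
swapAt-involutive (suc zero)    (x ∷ [])    = refl
swapAt-involutive (suc zero)    (x ∷ y ∷ w) = refl
swapAt-involutive (suc (suc i)) []          = refl
swapAt-involutive (suc (suc i)) (x ∷ w)     = cong (x ∷_) (swapAt-involutive (suc i) w)

swapAt-swapAt-comm : ∀ i k w → suc (suc i) < suc k →
  swapAt (suc i) (swapAt (suc k) w) ≡ swapAt (suc k) (swapAt (suc i) w)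
swapAt-swapAt-comm zero    zero          w           (s≤s ())
swapAt-swapAt-comm zero    (suc zero)    w           (s≤s (s≤s ()))
swapAt-swapAt-comm (suc i) zero          w           (s≤s ())
swapAt-swapAt-comm zero    (suc (suc k)) []          _       = refl
swapAt-swapAt-comm zero    (suc (suc k)) (x ∷ [])    _       = refl
swapAt-swapAt-comm zero    (suc (suc k)) (x ∷ y ∷ w) _       = refl
swapAt-swapAt-comm (suc i) (suc k)       []          _       = refl
swapAt-swapAt-comm (suc i) (suc k)       (x ∷ w)     (s≤s p) = cong (x ∷_) (swapAt-swapAt-comm i k w p)

swapAt-negAt-comm : ∀ i k w → suc (suc i) < suc k →
  swapAt (suc i) (negAt (suc k) w) ≡ negAt (suc k) (swapAt (suc i) w)
swapAt-negAt-comm zero    zero          w           (s≤s ())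
swapAt-negAt-comm zero    (suc zero)    w           (s≤s (s≤s ()))
swapAt-negAt-comm (suc i) zero          w           (s≤s ())
swapAt-negAt-comm zero    (suc (suc k)) []          _       = refl
swapAt-negAt-comm zero    (suc (suc k)) (x ∷ [])    _       = refl
swapAt-negAt-comm zero    (suc (suc k)) (x ∷ y ∷ w) _       = refl
swapAt-negAt-comm (suc i) (suc k)       []          _       = refl
swapAt-negAt-comm (suc i) (suc k)       (x ∷ w)     (s≤s p) = cong (x ∷_) (swapAt-negAt-comm i k w p)

data InRange (n : ℕ) : ℤ → Set where
  positive : ∀ {k} → 1 ≤ k → k ≤ n → InRange n (+ k)
  negative : ∀ {j} → j < n → InRange n -[1+ j ]

InRange-neg : ∀ {n x} → InRange n x → InRange n (ℤ.- x)
InRange-neg (positive {suc k} _ k<n) = negative k<n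
InRange-neg (negative j<n)           = positive (s≤s z≤n) j<n

record WellFormed (n : ℕ) (w : List ℤ) : Set where
  constructor wellFormed
  field
    inRange : All (InRange n) w
    length≡ : length w ≡ n

mulGen-swap : ∀ {n s} w → 1 ≤ s → s < n → mulGen n w s ≡ swapAt s w
mulGen-swap {n} {s} w p q with 1 ≤? s | s <? n | s ≟ n
... | yes _ | yes _ | _ = refl
... | no ¬p | _     | _ = ⊥-elim (¬p p)
... | yes _ | no ¬q | _ = ⊥-elim (¬q q)

mulGen-neg : ∀ {n} w → 1 ≤ n → mulGen n w n ≡ negAt n w
mulGen-neg {n} w p with 1 ≤? n | n <? n | n ≟ n
... | _     | yes q | _     = ⊥-elim (<-irrefl refl q)
... | yes _ | no _  | yes _ = refl
... | yes _ | no _  | no ¬r = ⊥-elim (¬r refl)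
... | no ¬p | no _  | _     = ⊥-elim (¬p p)

WellFormed-mulGen : ∀ {n w} s → WellFormed n w → WellFormed n (mulGen n w s)
WellFormed-mulGen {n} {w} s (wellFormed r l) with 1 ≤? s | s <? n | s ≟ n
... | yes _ | yes _ | _     = wellFormed (All-swapAt s r) (trans (length-swapAt s w) l)
... | yes _ | no _  | yes _ = wellFormed (All-negAt InRange-neg n r) (trans (length-negAt n w) l)
... | yes _ | no _  | no _  = wellFormed r l
... | no _  | _     | _     = wellFormed r l

WellFormed-act : ∀ {n w} ws → WellFormed n w → WellFormed n (act n w ws)
WellFormed-act []       wf = wf
WellFormed-act (s ∷ ws) wf = WellFormed-act ws (WellFormed-mulGen s wf)

mulGen-involutive : ∀ {n s} w → 1 ≤ s → s < n → mulGen n (mulGen n w s) s ≡ w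
mulGen-involutive {s = s} w p q = begin
  mulGen _ (mulGen _ w s) s ≡⟨ mulGen-swap _ p q ⟩
  swapAt s (mulGen _ w s)   ≡⟨ cong (swapAt s) (mulGen-swap w p q) ⟩
  swapAt s (swapAt s w)     ≡⟨ swapAt-involutive s w ⟩
  w                         ∎
  where open ≡-Reasoning

mulGen-comm : ∀ {n j l} w → 1 ≤ j → suc j < l → l ≤ n →
  mulGen n (mulGen n w l) j ≡ mulGen n (mulGen n w j) l
mulGen-comm {n} {suc j} {suc l} w p j+1<l l≤n with m≤n⇒m<n∨m≡n l≤n
... | inj₁ l<n = begin
  mulGen n (mulGen n w (suc l)) (suc j) ≡⟨ mulGen-swap _ p j<n ⟩
  swapAt (suc j) (mulGen n w (suc l))   ≡⟨ cong (swapAt (suc j)) (mulGen-swap w (s≤s z≤n) l<n) ⟩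
  swapAt (suc j) (swapAt (suc l) w)     ≡⟨ swapAt-swapAt-comm j l w j+1<l ⟩
  swapAt (suc l) (swapAt (suc j) w)     ≡⟨ cong (swapAt (suc l)) (mulGen-swap w p j<n) ⟨
  swapAt (suc l) (mulGen n w (suc j))   ≡⟨ mulGen-swap _ (s≤s z≤n) l<n ⟨
  mulGen n (mulGen n w (suc j)) (suc l) ∎
  where
    open ≡-Reasoning
    j<n = <-trans (<-trans (n<1+n (suc j)) j+1<l) l<n
... | inj₂ refl = begin
  mulGen n (mulGen n w n) (suc j) ≡⟨ mulGen-swap _ p j<n ⟩
  swapAt (suc j) (mulGen n w n)   ≡⟨ cong (swapAt (suc j)) (mulGen-neg w (s≤s z≤n)) ⟩
  swapAt (suc j) (negAt n w)      ≡⟨ swapAt-negAt-comm j l w j+1<l ⟩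
  negAt n (swapAt (suc j) w)      ≡⟨ cong (negAt n) (mulGen-swap w p j<n) ⟨
  negAt n (mulGen n w (suc j))    ≡⟨ mulGen-neg (mulGen n w (suc j)) (s≤s z≤n) ⟨
  mulGen n (mulGen n w (suc j)) n ∎
  where
    open ≡-Reasoning
    j<n = <-trans (n<1+n (suc j)) j+1<l

ascendingFrom : ℕ → ℕ → List ℤ
ascendingFrom a zero    = []
ascendingFrom a (suc k) = + a ∷ ascendingFrom (suc a) k

idn≡ascendingFrom : ∀ n → idn n ≡ ascendingFrom 1 n
idn≡ascendingFrom n = go id 0 n (λ _ → refl)
  where
    go : ∀ (h : ℕ → ℕ) c k → (∀ i → h i ≡ c + i) →
      map (λ i → + suc i) (applyUpTo h k) ≡ ascendingFrom (suc c) k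
    go h c zero    h≗ = refl
    go h c (suc k) h≗ = cong₂ _∷_ (cong (λ z → + suc z) (trans (h≗ 0) (+-identityʳ c)))
      (go (h ∘ suc) (suc c) k (λ i → trans (h≗ (suc i)) (+-suc c i)))

length-ascendingFrom : ∀ a k → length (ascendingFrom a k) ≡ k
length-ascendingFrom a zero    = refl
length-ascendingFrom a (suc k) = cong suc (length-ascendingFrom (suc a) k)

entry-ascendingFrom : ∀ a {k} i → i < k → entry (ascendingFrom a k) (suc i) ≡ + (a + i)
entry-ascendingFrom a {suc k} zero    _       = cong +_ (sym (+-identityʳ a))
entry-ascendingFrom a {suc k} (suc i) (s≤s p) = trans (entry-ascendingFrom (suc a) i p) (cong +_ (sym (+-suc a i)))

InRange-ascendingFrom : ∀ {n} a k → 1 ≤ a → a + k ≤ suc n → All (InRange n) (ascendingFrom a k)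
InRange-ascendingFrom a zero    _ _ = []
InRange-ascendingFrom a (suc k) p q =
  positive p (≤-pred (≤-trans (s≤s (m≤m+n a k)) q′)) ∷ InRange-ascendingFrom (suc a) k (s≤s z≤n) q′
  where q′ = ≤-trans (≤-reflexive (sym (+-suc a k))) q

WellFormed-idn : ∀ n → WellFormed n (idn n)
WellFormed-idn n rewrite idn≡ascendingFrom n =
  wellFormed (InRange-ascendingFrom 1 n ≤-refl ≤-refl) (length-ascendingFrom 1 n)

entry-idn : ∀ n {x} → 1 ≤ x → x ≤ n → entry (idn n) x ≡ + x
entry-idn n {suc x} _ x<n rewrite idn≡ascendingFrom n = entry-ascendingFrom 1 x x<n

WellFormed-eval : ∀ n ws → WellFormed n (eval n ws)
WellFormed-eval n ws = WellFormed-act ws (WellFormed-idn n)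

eval-snoc : ∀ n ws s → eval n (ws ++ s ∷ []) ≡ mulGen n (eval n ws) s
eval-snoc n ws s = foldl-++ (mulGen n) (idn n) ws (s ∷ [])

-- An inversion statistic bounding the Coxeter length from below

module Inversions (n : ℕ) where

  N : ℕ
  N = suc (2 * n)

  -- ranks the entries as 1 < 2 < ⋯ < n < -n < ⋯ < -1, so that key (- x) = N ∸ key x
  key : ℤ → ℕ
  key (+ k)      = k
  key -[1+ j ]   = 2 * n ∸ j

  inversion : ℤ → ℤ → ℕ
  inversion x y = ⟦ key x > key y ⟧ + ⟦ key x + key y > N ⟧

  inversionsWith : ℤ → List ℤ → ℕ
  inversionsWith x []       = 0
  inversionsWith x (y ∷ ys) = inversion x y + inversionsWith x ys

  inversions : List ℤ → ℕ
  inversions []       = 0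
  inversions (x ∷ xs) = inversionsWith x xs + ⟦ x <0⟧ + inversions xs

  key-neg : ∀ {x} → InRange n x → key (ℤ.- x) + key x ≡ N
  key-neg (positive {suc k} _ k<n) = begin
    (2 * n ∸ k) + suc k   ≡⟨ +-suc (2 * n ∸ k) k ⟩
    suc (2 * n ∸ k + k)   ≡⟨ cong suc (m∸n+n≡m (≤-trans (n≤1+n k) (≤-trans k<n (m≤m+n n (n + 0))))) ⟩
    N                     ∎
    where open ≡-Reasoning
  key-neg (negative {j} j<n) = cong suc (m+[n∸m]≡n (≤-trans (<⇒≤ j<n) (m≤m+n n (n + 0))))

  -- negating y exchanges the two summands of the inversion
  inversion-negʳ : ∀ x {y} → InRange n y → inversion x (ℤ.- y) ≡ inversion x y
  inversion-negʳ x {y} y∈ = begin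
    ⟦ kx > ky′ ⟧ + ⟦ kx + ky′ > N ⟧  ≡⟨ cong₂ _+_ first second ⟩
    ⟦ kx + ky > N ⟧ + ⟦ kx > ky ⟧    ≡⟨ +-comm ⟦ kx + ky > N ⟧ ⟦ kx > ky ⟧ ⟩
    ⟦ kx > ky ⟧ + ⟦ kx + ky > N ⟧    ∎
    where
      open ≡-Reasoning
      kx = key x
      ky = key y
      ky′ = key (ℤ.- y)
      first : ⟦ kx > ky′ ⟧ ≡ ⟦ kx + ky > N ⟧
      first = begin
        ⟦ kx > ky′ ⟧            ≡⟨ ⟦>⟧-+-cancelˡ ky kx ky′ ⟨
        ⟦ ky + kx > ky + ky′ ⟧  ≡⟨ cong₂ ⟦_>_⟧ (+-comm ky kx) (trans (+-comm ky ky′) (key-neg y∈)) ⟩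
        ⟦ kx + ky > N ⟧         ∎
      second : ⟦ kx + ky′ > N ⟧ ≡ ⟦ kx > ky ⟧
      second = begin
        ⟦ kx + ky′ > N ⟧         ≡⟨ cong₂ ⟦_>_⟧ (+-comm kx ky′) (sym (key-neg y∈)) ⟩
        ⟦ ky′ + kx > ky′ + ky ⟧  ≡⟨ ⟦>⟧-+-cancelˡ ky′ kx ky ⟩
        ⟦ kx > ky ⟧              ∎

  inversionsWith-swapAt : ∀ x i ys → inversionsWith x (swapAt i ys) ≡ inversionsWith x ys
  inversionsWith-swapAt x zero          ys           = refl
  inversionsWith-swapAt x (suc zero)    []           = refl
  inversionsWith-swapAt x (suc zero)    (a ∷ [])     = refl
  inversionsWith-swapAt x (suc zero)    (a ∷ b ∷ ys) = x∙yz≈y∙xz (inversion x b) (inversion x a) (inversionsWith x ys)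
  inversionsWith-swapAt x (suc (suc i)) []           = refl
  inversionsWith-swapAt x (suc (suc i)) (a ∷ ys)     = cong (_+_ (inversion x a)) (inversionsWith-swapAt x (suc i) ys)

  inversions-swapAt : ∀ i w → suc (suc i) ≤ length w →
    let k₁ = key (entry w (suc i)); k₂ = key (entry w (suc (suc i))) in
    inversions (swapAt (suc i) w) + ⟦ k₁ > k₂ ⟧ ≡ inversions w + ⟦ k₂ > k₁ ⟧
  inversions-swapAt zero (a ∷ b ∷ xs) _ = begin
    (⟦ kb > ka ⟧ + ⟦ kb + ka > N ⟧ + Wb) + nb + (Wa + na + F) + ⟦ ka > kb ⟧
      ≡⟨ cong (λ s → (⟦ kb > ka ⟧ + s + Wb) + nb + (Wa + na + F) + ⟦ ka > kb ⟧)
              (cong (⟦_> N ⟧) (+-comm kb ka)) ⟩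
    (⟦ kb > ka ⟧ + ⟦ ka + kb > N ⟧ + Wb) + nb + (Wa + na + F) + ⟦ ka > kb ⟧
      ≡⟨ rearrange ⟦ kb > ka ⟧ ⟦ ka > kb ⟧ ⟦ ka + kb > N ⟧ Wa Wb na nb F ⟩
    (⟦ ka > kb ⟧ + ⟦ ka + kb > N ⟧ + Wa) + na + (Wb + nb + F) + ⟦ kb > ka ⟧ ∎
    where
      open ≡-Reasoning
      ka = key a; kb = key b
      Wa = inversionsWith a xs; Wb = inversionsWith b xs
      na = ⟦ a <0⟧; nb = ⟦ b <0⟧
      F = inversions xs
      rearrange : ∀ g₁ g₂ s ca cb na nb F →
        ((g₁ + s) + cb) + nb + (ca + na + F) + g₂ ≡ ((g₂ + s) + ca) + na + (cb + nb + F) + g₁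
      rearrange = solve-∀
  inversions-swapAt zero (a ∷ []) (s≤s ())
  inversions-swapAt (suc i) (x ∷ xs) (s≤s le) = begin
    inversionsWith x (swapAt (suc i) xs) + ⟦ x <0⟧ + inversions (swapAt (suc i) xs) + g₁
      ≡⟨ cong (λ c → c + ⟦ x <0⟧ + inversions (swapAt (suc i) xs) + g₁) (inversionsWith-swapAt x (suc i) xs) ⟩
    Hx + inversions (swapAt (suc i) xs) + g₁  ≡⟨ +-assoc Hx _ g₁ ⟩
    Hx + (inversions (swapAt (suc i) xs) + g₁) ≡⟨ cong (_+_ Hx) (inversions-swapAt i xs le) ⟩
    Hx + (inversions xs + g₂)                  ≡⟨ +-assoc Hx _ g₂ ⟨
    Hx + inversions xs + g₂                    ∎
    where
      open ≡-Reasoning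
      Hx = inversionsWith x xs + ⟦ x <0⟧
      g₁ = ⟦ key (entry xs (suc i)) > key (entry xs (suc (suc i))) ⟧
      g₂ = ⟦ key (entry xs (suc (suc i))) > key (entry xs (suc i)) ⟧

  inversionsWith-negAt : ∀ a i ys → InRange n (entry ys (suc i)) →
    inversionsWith a (negAt (suc i) ys) ≡ inversionsWith a ys
  inversionsWith-negAt a zero    []       _  = refl
  inversionsWith-negAt a zero    (y ∷ ys) y∈ = cong (_+ inversionsWith a ys) (inversion-negʳ a y∈)
  inversionsWith-negAt a (suc i) []       _  = refl
  inversionsWith-negAt a (suc i) (y ∷ ys) y∈ = cong (_+_ (inversion a y)) (inversionsWith-negAt a i ys y∈)

  inversions-negAt : ∀ i w → length w ≡ suc i → InRange n (entry w (suc i)) →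
    inversions (negAt (suc i) w) + ⟦ entry w (suc i) <0⟧ ≡ inversions w + ⟦ ℤ.- entry w (suc i) <0⟧
  inversions-negAt zero (x ∷ []) _ _ = swap-summands ⟦ ℤ.- x <0⟧ ⟦ x <0⟧
    where
      swap-summands : ∀ a b → a + 0 + b ≡ b + 0 + a
      swap-summands = solve-∀
  inversions-negAt (suc i) (x ∷ xs) len x∈ = begin
    inversionsWith x (negAt (suc i) xs) + ⟦ x <0⟧ + inversions (negAt (suc i) xs) + g₁
      ≡⟨ cong (λ c → c + ⟦ x <0⟧ + inversions (negAt (suc i) xs) + g₁) (inversionsWith-negAt x i xs x∈) ⟩
    Hx + inversions (negAt (suc i) xs) + g₁   ≡⟨ +-assoc Hx _ g₁ ⟩
    Hx + (inversions (negAt (suc i) xs) + g₁) ≡⟨ cong (_+_ Hx) (inversions-negAt i xs (suc-injective len) x∈) ⟩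
    Hx + (inversions xs + g₂)                 ≡⟨ +-assoc Hx _ g₂ ⟨
    Hx + inversions xs + g₂                   ∎
    where
      open ≡-Reasoning
      Hx = inversionsWith x xs + ⟦ x <0⟧
      g₁ = ⟦ entry xs (suc i) <0⟧
      g₂ = ⟦ ℤ.- entry xs (suc i) <0⟧

  inversions-mulGen-≤ : ∀ {w s} → WellFormed n w → 1 ≤ s → s ≤ n →
    inversions (mulGen n w s) ≤ suc (inversions w)
  inversions-mulGen-≤ {w} {suc i} (wellFormed r len) p s≤n with m≤n⇒m<n∨m≡n s≤n
  ... | inj₁ s<n = begin
    inversions (mulGen n w (suc i))       ≡⟨ cong inversions (mulGen-swap w p s<n) ⟩
    inversions (swapAt (suc i) w)         ≤⟨ m≤m+n _ _ ⟩
    inversions (swapAt (suc i) w) + _     ≡⟨ inversions-swapAt i w (≤-trans s<n (≤-reflexive (sym len))) ⟩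
    inversions w + _                      ≤⟨ +-monoʳ-≤ (inversions w) (⟦>⟧≤1 (key (entry w (suc (suc i)))) _) ⟩
    inversions w + 1                      ≡⟨ +-comm (inversions w) 1 ⟩
    suc (inversions w)                    ∎
    where open ≤-Reasoning
  ... | inj₂ s≡n = begin
    inversions (mulGen n w (suc i))       ≡⟨ cong (λ z → inversions (mulGen n w z)) s≡n ⟩
    inversions (mulGen n w n)             ≡⟨ cong inversions (mulGen-neg w (≤-trans p s≤n)) ⟩
    inversions (negAt n w)                ≡⟨ cong (λ z → inversions (negAt z w)) s≡n ⟨
    inversions (negAt (suc i) w)          ≤⟨ m≤m+n _ _ ⟩
    inversions (negAt (suc i) w) + _      ≡⟨ inversions-negAt i w len′ (All-entry r p (≤-reflexive (sym len′))) ⟩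
    inversions w + _                      ≤⟨ +-monoʳ-≤ (inversions w) (⟦<0⟧≤1 _) ⟩
    inversions w + 1                      ≡⟨ +-comm (inversions w) 1 ⟩
    suc (inversions w)                    ∎
    where
      open ≤-Reasoning
      len′ = trans len (sym s≡n)

  data Ascent (w : List ℤ) : ℕ → Set where
    swap-ascent : ∀ {l} → 1 ≤ l → l < n → key (entry w l) < key (entry w (suc l)) → Ascent w l
    neg-ascent  : ∀ {k} → 1 ≤ n → entry w n ≡ + suc k → Ascent w n

  inversions-mulGen-ascent : ∀ {w l} → WellFormed n w → Ascent w l →
    inversions (mulGen n w l) ≡ suc (inversions w)
  inversions-mulGen-ascent {w} {suc i} (wellFormed _ len) (swap-ascent p l<n asc) = begin
    inversions (mulGen n w (suc i))         ≡⟨ cong inversions (mulGen-swap w p l<n) ⟩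
    inversions (swapAt (suc i) w)           ≡⟨ +-identityʳ _ ⟨
    inversions (swapAt (suc i) w) + 0       ≡⟨ cong (_+_ (inversions (swapAt (suc i) w))) (⟦>⟧-≤ (<⇒≤ asc)) ⟨
    inversions (swapAt (suc i) w) + _       ≡⟨ inversions-swapAt i w (≤-trans l<n (≤-reflexive (sym len))) ⟩
    inversions w + _                        ≡⟨ cong (_+_ (inversions w)) (⟦>⟧-< asc) ⟩
    inversions w + 1                        ≡⟨ +-comm (inversions w) 1 ⟩
    suc (inversions w)                      ∎
    where open ≡-Reasoning
  inversions-mulGen-ascent {w} (wellFormed r len) (neg-ascent p wₙ>0) = begin
    inversions (mulGen n w n)               ≡⟨ cong inversions (mulGen-neg w p) ⟩
    inversions (negAt n w)                  ≡⟨ cong (λ z → inversions (negAt z w)) n≡1+i ⟩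
    inversions (negAt (suc i) w)            ≡⟨ +-identityʳ _ ⟨
    inversions (negAt (suc i) w) + 0        ≡⟨ cong (λ z → inversions (negAt (suc i) w) + ⟦ z <0⟧) wᵢ>0 ⟨
    inversions (negAt (suc i) w) + _        ≡⟨ inversions-negAt i w len′ (All-entry r (s≤s z≤n) (≤-reflexive (sym len′))) ⟩
    inversions w + ⟦ ℤ.- entry w (suc i) <0⟧ ≡⟨ cong (λ z → inversions w + ⟦ ℤ.- z <0⟧) wᵢ>0 ⟩
    inversions w + 1                        ≡⟨ +-comm (inversions w) 1 ⟩
    suc (inversions w)                      ∎
    where
      open ≡-Reasoning
      i = n ∸ 1
      n≡1+i = sym (suc-∸1 p)
      len′ = trans len n≡1+i
      wᵢ>0 = trans (cong (entry w) (sym n≡1+i)) wₙ>0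

  inversionsWith-ascendingFrom : ∀ x b k → x < b → x + (b + k) ≤ N → inversionsWith (+ x) (ascendingFrom b k) ≡ 0
  inversionsWith-ascendingFrom x b zero    _   _ = refl
  inversionsWith-ascendingFrom x b (suc k) x<b bound =
    trans (cong₂ (λ u v → u + v + inversionsWith (+ x) (ascendingFrom (suc b) k))
                 (⟦>⟧-≤ (<⇒≤ x<b)) (⟦>⟧-≤ (≤-trans (+-monoʳ-≤ x (m≤m+n b (suc k))) bound)))
          (inversionsWith-ascendingFrom x (suc b) k (m<n⇒m<1+n x<b)
            (≤-trans (≤-reflexive (cong (_+_ x) (sym (+-suc b k)))) bound))

  inversions-ascendingFrom : ∀ a k → 1 ≤ a → a + k ≤ suc n → inversions (ascendingFrom a k) ≡ 0
  inversions-ascendingFrom a zero    _ _     = refl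
  inversions-ascendingFrom a (suc k) _ bound =
    cong₂ (λ u v → u + 0 + v) (inversionsWith-ascendingFrom a (suc a) k ≤-refl pair-bound)
                              (inversions-ascendingFrom (suc a) k (s≤s z≤n) bound′)
    where
      bound′ : suc a + k ≤ suc n
      bound′ = ≤-trans (≤-reflexive (sym (+-suc a k))) bound
      a+k≤n : a + k ≤ n
      a+k≤n = ≤-pred bound′
      pair-bound : a + (suc a + k) ≤ N
      pair-bound = begin
        a + (suc a + k)     ≡⟨ +-suc a (a + k) ⟩
        suc (a + (a + k))   ≤⟨ s≤s (+-mono-≤ (≤-trans (m≤m+n a k) a+k≤n) a+k≤n) ⟩
        suc (n + n)         ≡⟨ cong (λ z → suc (n + z)) (+-identityʳ n) ⟨
        N                   ∎
        where open ≤-Reasoning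

  inversions-idn : inversions (idn n) ≡ 0
  inversions-idn = trans (cong inversions (idn≡ascendingFrom n)) (inversions-ascendingFrom 1 n ≤-refl ≤-refl)

  inversions-act-≤ : ∀ {w} ws → WellFormed n w → ValidWord n ws → inversions (act n w ws) ≤ inversions w + length ws
  inversions-act-≤ {w} []       _  _ = ≤-reflexive (sym (+-identityʳ (inversions w)))
  inversions-act-≤ {w} (s ∷ ws) wf ((p , q) ∷ valid) = begin
    inversions (act n (mulGen n w s) ws)   ≤⟨ inversions-act-≤ ws (WellFormed-mulGen s wf) valid ⟩
    inversions (mulGen n w s) + length ws  ≤⟨ +-monoˡ-≤ (length ws) (inversions-mulGen-≤ wf p q) ⟩
    suc (inversions w) + length ws         ≡⟨ +-suc (inversions w) (length ws) ⟨
    inversions w + suc (length ws)         ∎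
    where open ≤-Reasoning

  inversions-eval-≤ : ∀ ws → ValidWord n ws → inversions (eval n ws) ≤ length ws
  inversions-eval-≤ ws valid = subst (λ z → inversions (eval n ws) ≤ z + length ws) inversions-idn
    (inversions-act-≤ ws (WellFormed-idn n) valid)

  isLength-eval : ∀ {ws} → ValidWord n ws → inversions (eval n ws) ≡ length ws →
    IsLength n (eval n ws) (length ws)
  isLength-eval {ws} valid inv≡len =
    (ws , valid , refl , refl) ,
    λ ws′ valid′ eq → subst (_≤ length ws′) (trans (cong inversions eq) inv≡len) (inversions-eval-≤ ws′ valid′)

isLength-unique : ∀ {n w a b} → IsLength n w a → IsLength n w b → a ≡ b
isLength-unique ((ws , v , la , e) , mina) ((ws′ , v′ , lb , e′) , minb) =
  ≤-antisym (subst (_ ≤_) lb (mina ws′ v′ e′)) (subst (_ ≤_) la (minb ws v e))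

BruhatLt-length< : ∀ {n w w′} → BruhatLt n w w′ →
  ∃[ a ] ∃[ b ] IsLength n w a × IsLength n w′ b × a < b
BruhatLt-length< (step (_ , (a , b , la , lb , a<b))) = a , b , la , lb , a<b
BruhatLt-length< (step-then (_ , (a , b , la , lb , a<b)) rest) with BruhatLt-length< rest
... | c , d , lc , ld , c<d = a , d , la , ld , <-trans a<b (subst (_< d) (isLength-unique lc lb) c<d)

val-zero : ∀ {m} (D : Vec Sign m) → val D 0 ≡ pls
val-zero []      = refl
val-zero (_ ∷ _) = refl

val-beyond : ∀ {m} (D : Vec Sign m) {k} → m < k → val D k ≡ pls
val-beyond []      _                   = refl
val-beyond (x ∷ D) {suc zero}    (s≤s ())
val-beyond (x ∷ D) {suc (suc k)} (s≤s p) = val-beyond D p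

val≡zer⇒box : ∀ {m} (D : Vec Sign m) {k} → val D k ≡ zer → 1 ≤ k × k ≤ m
val≡zer⇒box {m} D {k} eq with k ≤? m
... | no k≰m = case trans (sym eq) (val-beyond D (≰⇒> k≰m)) of λ ()
... | yes k≤m with k
...   | zero  = case trans (sym eq) (val-zero D) of λ ()
...   | suc _ = s≤s z≤n , k≤m

≢zer⇒≡pls : ∀ {s} → s ≢ zer → s ≡ pls
≢zer⇒≡pls {zer} s≢zer = ⊥-elim (s≢zer refl)
≢zer⇒≡pls {pls} _     = refl

label-≤ : ∀ {n k} → k ≤ n → label n k ≡ k
label-≤ {n} {k} k≤n with k ≤? n
... | yes _   = refl
... | no k≰n  = ⊥-elim (k≰n k≤n)

label-> : ∀ {n k} → n < k → label n k ≡ 2 * n ∸ k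
label-> {n} {k} n<k with k ≤? n
... | yes k≤n = ⊥-elim (<-irrefl refl (<-≤-trans n<k k≤n))
... | no _    = refl

mulIf : ℕ → Sign → ℕ → List ℤ → List ℤ
mulIf n zer l w = mulGen n w l
mulIf n pls l w = w

snocIf : Sign → ℕ → List ℕ → List ℕ
snocIf zer l ws = ws ++ l ∷ []
snocIf pls l ws = ws

sucIf : Sign → ℕ → ℕ
sucIf zer k = suc k
sucIf pls k = k

negIf : Sign → ℤ → ℤ
negIf zer x = ℤ.- x
negIf pls x = x

transposeIf : Sign → ℕ → ℕ → ℕ
transposeIf zer l x = transpose l x
transposeIf pls l x = x

vWord-suc : ∀ {m} n (D : Vec Sign m) q →
  vWord n D (suc q) ≡ snocIf (val D (m ∸ q)) (label n (m ∸ q)) (vWord n D q)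
vWord-suc {m} n D q with val D (m ∸ q)
... | zer = refl
... | pls = refl

eval-snocIf : ∀ n s l ws → eval n (snocIf s l ws) ≡ mulIf n s l (eval n ws)
eval-snocIf n zer l ws = eval-snoc n ws l
eval-snocIf n pls l ws = refl

length-snocIf : ∀ s l ws → length (snocIf s l ws) ≡ sucIf s (length ws)
length-snocIf zer l ws = trans (length-++ ws) (+-comm (length ws) 1)
length-snocIf pls l ws = refl

entry-mulIf : ∀ {n} s {l w} x → 1 ≤ l → l < n → length w ≡ n →
  entry (mulIf n s l w) x ≡ entry w (transposeIf s l x)
entry-mulIf zer {suc i} {w} x p l<n len =
  trans (cong (λ z → entry z x) (mulGen-swap w p l<n)) (entry-swapAt i w x (≤-trans l<n (≤-reflexive (sym len))))
entry-mulIf pls x _ _ _ = refl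

entry-mulIf-other : ∀ {n} s {w x} → 1 ≤ n → x ≢ n → entry (mulIf n s n w) x ≡ entry w x
entry-mulIf-other {suc i} zer {w} {x} p x≢n = trans (cong (λ z → entry z x) (mulGen-neg w p)) (entry-negAt-other i w x x≢n)
entry-mulIf-other pls _ _ = refl

entry-mulIf-self : ∀ {n} s {w} → 1 ≤ n → entry (mulIf n s n w) n ≡ negIf s (entry w n)
entry-mulIf-self {suc i} zer {w} p = trans (cong (λ z → entry z (suc i)) (mulGen-neg w p)) (entry-negAt-self i w)
entry-mulIf-self pls _ = refl

transposeIf-≤ : ∀ s {l x B} → x ≤ B → suc l ≤ B → transposeIf s l x ≤ B
transposeIf-≤ zer = transpose-≤
transposeIf-≤ pls x≤B _ = x≤B

transposeIf-pos : ∀ s {l x} → 1 ≤ l → 1 ≤ x → 1 ≤ transposeIf s l x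
transposeIf-pos zer {suc l} {suc x} _ _ = s≤s z≤n
transposeIf-pos pls _ 1≤x = 1≤x

transposeIf-fix-above : ∀ s {l x} → suc l < x → transposeIf s l x ≡ x
transposeIf-fix-above zer = transpose-fix-above
transposeIf-fix-above pls _ = refl

transposeIf-fix-below : ∀ s {l x} → x < l → transposeIf s l x ≡ x
transposeIf-fix-below zer = transpose-fix-below
transposeIf-fix-below pls _ = refl

markPlus : ∀ {m} → Vec Sign m → ℕ → Vec Sign m
markPlus []       k             = []
markPlus (x ∷ xs) zero          = x ∷ xs
markPlus (x ∷ xs) (suc zero)    = pls ∷ xs
markPlus (x ∷ xs) (suc (suc k)) = x ∷ markPlus xs (suc k)

val-markPlus-self : ∀ {m} (D : Vec Sign m) k → val (markPlus D k) k ≡ pls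
val-markPlus-self []       k             = refl
val-markPlus-self (x ∷ xs) zero          = refl
val-markPlus-self (x ∷ xs) (suc zero)    = refl
val-markPlus-self (x ∷ xs) (suc (suc k)) = val-markPlus-self xs (suc k)

val-markPlus-other : ∀ {m} (D : Vec Sign m) k {c} → c ≢ k → val (markPlus D k) c ≡ val D c
val-markPlus-other []       k             _ = refl
val-markPlus-other (x ∷ xs) zero          _ = refl
val-markPlus-other (x ∷ xs) (suc zero)    {zero}        _   = refl
val-markPlus-other (x ∷ xs) (suc zero)    {suc zero}    c≢k = ⊥-elim (c≢k refl)
val-markPlus-other (x ∷ xs) (suc zero)    {suc (suc c)} _   = refl
val-markPlus-other (x ∷ xs) (suc (suc k)) {zero}        _   = refl
val-markPlus-other (x ∷ xs) (suc (suc k)) {suc zero}    _   = refl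
val-markPlus-other (x ∷ xs) (suc (suc k)) {suc (suc c)} c≢k = val-markPlus-other xs (suc k) (c≢k ∘ cong suc)

AvoidsPattern : ∀ {m} → ℕ → Vec Sign m → Set
AvoidsPattern {m} n D =
  ∀ k → n < k → k ≤ m → val D k ≡ zer → ¬ (val D (k ∸ 1) ≡ pls × val D (2 * n ∸ k + 1) ≡ pls)

-- The elements v_(q) of a diagram

module Diagram (n : ℕ) (1≤n : 1 ≤ n) (m : ℕ) (m<2n : m < 2 * n) (D : Vec Sign m) where

  open Inversions n

  v : ℕ → List ℤ
  v q = eval n (vWord n D q)

  len : ℕ → ℕ
  len q = length (vWord n D q)

  -- after q steps the next box to be read is b_c, where q + c ≡ m
  m∸q≡c : ∀ {q c} → q + c ≡ m → m ∸ q ≡ c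
  m∸q≡c {q} {c} q+c≡m = trans (cong (_∸ q) (sym q+c≡m)) (m+n∸m≡n q c)

  v-suc : ∀ {q c} → q + c ≡ m → v (suc q) ≡ mulIf n (val D c) (label n c) (v q)
  v-suc {q} {c} q+c≡m = begin
    eval n (vWord n D (suc q))                       ≡⟨ cong (eval n) (vWord-suc n D q) ⟩
    eval n (snocIf (val D b) (label n b) ws)         ≡⟨ eval-snocIf n (val D b) (label n b) ws ⟩
    mulIf n (val D b) (label n b) (v q)              ≡⟨ cong (λ b′ → mulIf n (val D b′) (label n b′) (v q)) (m∸q≡c q+c≡m) ⟩
    mulIf n (val D c) (label n c) (v q)              ∎
    where
      open ≡-Reasoning
      b = m ∸ q
      ws = vWord n D q

  len-suc : ∀ {q c} → q + c ≡ m → len (suc q) ≡ sucIf (val D c) (len q)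
  len-suc {q} {c} q+c≡m = begin
    length (vWord n D (suc q))                       ≡⟨ cong length (vWord-suc n D q) ⟩
    length (snocIf (val D b) (label n b) ws)         ≡⟨ length-snocIf (val D b) (label n b) ws ⟩
    sucIf (val D b) (len q)                          ≡⟨ cong (λ b′ → sucIf (val D b′) (len q)) (m∸q≡c q+c≡m) ⟩
    sucIf (val D c) (len q)                          ∎
    where
      open ≡-Reasoning
      b = m ∸ q
      ws = vWord n D q

  read-zer : ∀ {q c} → q + c ≡ m → val D c ≡ zer →
    v (suc q) ≡ mulGen n (v q) (label n c) × len (suc q) ≡ suc (len q)
  read-zer {q} q+c≡m box≡0 =
    trans (v-suc q+c≡m) (cong (λ s → mulIf n s _ (v q)) box≡0) ,
    trans (len-suc q+c≡m) (cong (λ s → sucIf s (len q)) box≡0)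

  read-pls : ∀ {q c} → q + c ≡ m → val D c ≡ pls → v (suc q) ≡ v q × len (suc q) ≡ len q
  read-pls {q} q+c≡m box≡+ =
    trans (v-suc q+c≡m) (cong (λ s → mulIf n s _ (v q)) box≡+) ,
    trans (len-suc q+c≡m) (cong (λ s → sucIf s (len q)) box≡+)

  label-range : ∀ {c} → 1 ≤ c → c ≤ m → 1 ≤ label n c × label n c ≤ n
  label-range {c} 1≤c c≤m with n <? c
  ... | no c≯n  rewrite label-≤ (≮⇒≥ c≯n) = 1≤c , ≮⇒≥ c≯n
  ... | yes n<c rewrite label-> n<c =
    m<n⇒0<n∸m (≤-<-trans c≤m m<2n) ,
    ≤-trans (∸-monoʳ-≤ (2 * n) (<⇒≤ n<c)) (≤-reflexive (trans (cong (_∸ n) (2*n≡n+n n)) (m+n∸m≡n n n)))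

  valid : ∀ q → ValidWord n (vWord n D q)
  valid zero    = []
  valid (suc q) rewrite vWord-suc n D q = snoc-valid (val D (m ∸ q)) refl
    where
      snoc-valid : ∀ s → val D (m ∸ q) ≡ s → ValidWord n (snocIf s (label n (m ∸ q)) (vWord n D q))
      snoc-valid zer box≡0 = ++⁺ (valid q) (uncurry label-range (val≡zer⇒box D box≡0) ∷ [])
      snoc-valid pls _     = valid q

  WellFormed-v : ∀ q → WellFormed n (v q)
  WellFormed-v q = WellFormed-eval n (vWord n D q)

  -- The boxes b_k with k > n carry the labels 2n ∸ k and are read first, in increasing order
  -- of label; the letter s_t is used iff the box b_{2n ∸ t} is 0.  The resulting element
  -- is the unsigned permutation π (n ∸ 1), whose partial products are π L.
  Used : ℕ → Set
  Used t = val D (2 * n ∸ t) ≡ zer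

  π : ℕ → ℕ → ℕ
  π zero    x = x
  π (suc L) x = π L (transposeIf (val D (2 * n ∸ suc L)) (suc L) x)

  π-fix-above : ∀ L {x} → suc L < x → π L x ≡ x
  π-fix-above zero    _     = refl
  π-fix-above (suc L) L+2<x = trans (cong (π L) (transposeIf-fix-above (val D (2 * n ∸ suc L)) L+2<x))
                                    (π-fix-above L (≤-trans (n≤1+n _) L+2<x))

  π-≤ : ∀ L {x} → x ≤ suc L → π L x ≤ suc L
  π-≤ zero    x≤1 = x≤1
  π-≤ (suc L) {x} x≤L+2 with m≤n⇒m<n∨m≡n (transposeIf-≤ (val D (2 * n ∸ suc L)) {suc L} {x} x≤L+2 ≤-refl)
  ... | inj₁ x′≤L+1 = m≤n⇒m≤1+n (π-≤ L (≤-pred x′≤L+1))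
  ... | inj₂ x′≡L+2 = ≤-reflexive (trans (cong (π L) x′≡L+2) (π-fix-above L ≤-refl))

  π-bounded : ∀ L {x B} → x ≤ B → suc L ≤ B → π L x ≤ B
  π-bounded L {x} x≤B L+1≤B with x ≤? suc L
  ... | yes x≤L+1 = ≤-trans (π-≤ L x≤L+1) L+1≤B
  ... | no  x≰L+1 = ≤-trans (≤-reflexive (π-fix-above L (≰⇒> x≰L+1))) x≤B

  π-pos : ∀ L {x} → 1 ≤ x → 1 ≤ π L x
  π-pos zero    1≤x = 1≤x
  π-pos (suc L) 1≤x = π-pos L (transposeIf-pos (val D (2 * n ∸ suc L)) (s≤s z≤n) 1≤x)

  π-unused : ∀ L x → (∀ t → 1 ≤ t → t ≤ L → val D (2 * n ∸ t) ≡ pls) → π L x ≡ x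
  π-unused zero    x _      = refl
  π-unused (suc L) x unused with val D (2 * n ∸ suc L) | unused (suc L) (s≤s z≤n) ≤-refl
  ... | pls | _ = π-unused L x (λ t 1≤t t≤L → unused t 1≤t (m≤n⇒m≤1+n t≤L))

  RunTo : ℕ → ℕ → ℕ → Set
  RunTo L b e = (∀ t → b ≤ t → t < e → t ≤ L × Used t) × ¬ (e ≤ L × Used e)

  RunTo-suc : ∀ {L b e} → RunTo L b e → (e ≡ suc L → ¬ Used e) → RunTo (suc L) b e
  RunTo-suc (inside , stop) stop′ =
    (λ t b≤t t<e → m≤n⇒m≤1+n (proj₁ (inside t b≤t t<e)) , proj₂ (inside t b≤t t<e)) ,
    λ { (e≤ , used) → case m≤n⇒m<n∨m≡n e≤ of λ
          { (inj₁ e<L+1) → stop (≤-pred e<L+1 , used)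
          ; (inj₂ e≡L+1) → stop′ e≡L+1 used } }

  π-inversion-used : ∀ L → Used (suc L) → (∀ {b e} → b < e → π L e ≤ π L b → RunTo L b e) →
    ∀ {b e} → Around (suc L) b → Around (suc L) e → b < e →
    π L (transpose (suc L) e) ≤ π L (transpose (suc L) b) → RunTo (suc L) b e
  π-inversion-used L used ih here here b<e _ = ⊥-elim (<-irrefl refl b<e)
  π-inversion-used L used ih here next _ _ =
    (λ t b≤t t<e → ≤-pred t<e , subst Used (≤-antisym b≤t (≤-pred t<e)) used) , λ (e≤ , _) → 1+n≰n e≤
  π-inversion-used L used ih here (elsewhere {e} e≢l e≢l+1) b<e πe≤πb =
    ⊥-elim (e≢l+1 (≤-antisym e≤l+1 b<e))
    where
      e≤l+1 = subst₂ _≤_ (trans (cong (π L) (transpose-other _ e e≢l e≢l+1)) (π-fix-above L b<e))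
                         (trans (cong (π L) (transpose-self (suc L))) (π-fix-above L ≤-refl)) πe≤πb
  π-inversion-used L used ih next here b<e _ = ⊥-elim (<-asym b<e (n<1+n _))
  π-inversion-used L used ih next next b<e _ = ⊥-elim (<-irrefl refl b<e)
  π-inversion-used L used ih next (elsewhere {e} e≢l e≢l+1) b<e πe≤πb = ⊥-elim (<-irrefl refl (<-≤-trans b<e e≤l))
    where
      e≤l = begin
        e                                      ≡⟨ π-fix-above L (<-trans (n<1+n _) b<e) ⟨
        π L e                                  ≡⟨ cong (π L) (transpose-other _ e e≢l e≢l+1) ⟨
        π L (transpose (suc L) e)              ≤⟨ πe≤πb ⟩
        π L (transpose (suc L) (suc (suc L)))  ≡⟨ cong (π L) (transpose-suc (suc L)) ⟩
        π L (suc L)                            ≤⟨ π-≤ L ≤-refl ⟩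
        suc L                                  ≤⟨ n≤1+n _ ⟩
        suc (suc L)                            ∎
        where open ≤-Reasoning
  π-inversion-used L used ih (elsewhere {b} b≢l b≢l+1) here b<e πe≤πb =
    ⊥-elim (1+n≰n (≤-trans l+1≤πb (π-≤ L (<⇒≤ b<e))))
    where
      l+1≤πb = subst₂ _≤_ (trans (cong (π L) (transpose-self (suc L))) (π-fix-above L ≤-refl))
                          (cong (π L) (transpose-other _ b b≢l b≢l+1)) πe≤πb
  π-inversion-used L used ih (elsewhere {b} b≢l b≢l+1) next b<e πe≤πb =
    (λ t b≤t t<e → last-step t b≤t (≤-pred t<e)) , λ (e≤ , _) → 1+n≰n e≤
    where
      b<l = ≤∧≢⇒< (≤-pred b<e) b≢l
      run = ih b<l (subst₂ _≤_ (cong (π L) (transpose-suc (suc L))) (cong (π L) (transpose-other _ b b≢l b≢l+1)) πe≤πb)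
      last-step : ∀ t → b ≤ t → t ≤ suc L → t ≤ suc L × Used t
      last-step t b≤t t≤l with m≤n⇒m<n∨m≡n t≤l
      ... | inj₁ t<l  = m≤n⇒m≤1+n (proj₁ (proj₁ run t b≤t t<l)) , proj₂ (proj₁ run t b≤t t<l)
      ... | inj₂ refl = ≤-refl , used
  π-inversion-used L used ih (elsewhere {b} b≢l b≢l+1) (elsewhere {e} e≢l e≢l+1) b<e πe≤πb =
    RunTo-suc (ih b<e (subst₂ _≤_ (cong (π L) (transpose-other _ e e≢l e≢l+1))
                                  (cong (π L) (transpose-other _ b b≢l b≢l+1)) πe≤πb))
              (λ e≡l → ⊥-elim (e≢l e≡l))

  -- the only inversions of π L close a run of used letters
  π-inversion : ∀ L {b e} → b < e → π L e ≤ π L b → RunTo L b e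
  π-inversion zero    b<e πe≤πb = ⊥-elim (<⇒≱ b<e πe≤πb)
  π-inversion (suc L) {b} {e} b<e πe≤πb with val D (2 * n ∸ suc L) in box
  ... | pls = RunTo-suc (π-inversion L b<e πe≤πb) (λ { refl used → case trans (sym box) used of λ () })
  ... | zer = π-inversion-used L box (π-inversion L) (around (suc L) b) (around (suc L) e) b<e πe≤πb

  shift : ∀ {q c} → suc q + c ≡ m → q + suc c ≡ m
  shift {q} {c} eq = trans (+-suc q c) eq

  label<n : ∀ {a c} → n < c → a + c ≡ 2 * n → a < n
  label<n {a} {c} n<c a+c≡2n = +-cancelʳ-< c a n (begin-strict
    a + c    ≡⟨ a+c≡2n ⟩
    2 * n    ≡⟨ 2*n≡n+n n ⟩
    n + n    <⟨ +-monoʳ-< n n<c ⟩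
    n + c    ∎)
    where open ≤-Reasoning

  entry-v-suc : ∀ {q c l} x → q + c ≡ m → label n c ≡ l → 1 ≤ l → l < n →
    entry (v (suc q)) x ≡ entry (v q) (transposeIf (val D c) l x)
  entry-v-suc {q} {c} {l} x q+c≡m label≡l 1≤l l<n = begin
    entry (v (suc q)) x                            ≡⟨ cong (λ w → entry w x) (v-suc q+c≡m) ⟩
    entry (mulIf n (val D c) (label n c) (v q)) x  ≡⟨ cong (λ l′ → entry (mulIf n (val D c) l′ (v q)) x) label≡l ⟩
    entry (mulIf n (val D c) l (v q)) x            ≡⟨ entry-mulIf (val D c) x 1≤l l<n (WellFormed.length≡ (WellFormed-v q)) ⟩
    entry (v q) (transposeIf (val D c) l x)        ∎
    where open ≡-Reasoning

  entry-v-suc-middle : ∀ {q} x → q + n ≡ m → x ≢ n → entry (v (suc q)) x ≡ entry (v q) x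
  entry-v-suc-middle {q} x q+n≡m x≢n = begin
    entry (v (suc q)) x                            ≡⟨ cong (λ w → entry w x) (v-suc q+n≡m) ⟩
    entry (mulIf n (val D n) (label n n) (v q)) x  ≡⟨ cong (λ l → entry (mulIf n (val D n) l (v q)) x) (label-≤ ≤-refl) ⟩
    entry (mulIf n (val D n) n (v q)) x            ≡⟨ entry-mulIf-other (val D n) 1≤n x≢n ⟩
    entry (v q) x                                  ∎
    where open ≡-Reasoning

  entry-v-suc-middle-self : ∀ {q} → q + n ≡ m → entry (v (suc q)) n ≡ negIf (val D n) (entry (v q) n)
  entry-v-suc-middle-self {q} q+n≡m = begin
    entry (v (suc q)) n                            ≡⟨ cong (λ w → entry w n) (v-suc q+n≡m) ⟩
    entry (mulIf n (val D n) (label n n) (v q)) n  ≡⟨ cong (λ l → entry (mulIf n (val D n) l (v q)) n) (label-≤ ≤-refl) ⟩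
    entry (mulIf n (val D n) n (v q)) n            ≡⟨ entry-mulIf-self (val D n) 1≤n ⟩
    negIf (val D n) (entry (v q) n)                ∎
    where open ≡-Reasoning

  entry-v-phase1 : ∀ q {c L} → q + c ≡ m → n ≤ c → L + suc c ≡ 2 * n →
    ∀ {x} → 1 ≤ x → x ≤ n → entry (v q) x ≡ + π L x
  entry-v-phase1 zero {c} {L} c≡m _ L+c+1≡2n {x} 1≤x x≤n =
    trans (entry-idn n 1≤x x≤n) (cong +_ (sym (π-unused L x beyond-m)))
    where
      beyond-m : ∀ t → 1 ≤ t → t ≤ L → val D (2 * n ∸ t) ≡ pls
      beyond-m t _ t≤L = val-beyond D (m+n≤o⇒m≤o∸n (suc m) (begin
        suc (m + t)    ≤⟨ s≤s (+-monoʳ-≤ m t≤L) ⟩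
        suc (m + L)    ≡⟨ cong suc (+-comm m L) ⟩
        suc (L + m)    ≡⟨ +-suc L m ⟨
        L + suc m      ≡⟨ cong (λ z → L + suc z) (sym c≡m) ⟩
        L + suc c      ≡⟨ L+c+1≡2n ⟩
        2 * n          ∎))
        where open ≤-Reasoning
  entry-v-phase1 (suc q) {c} {zero} q+c≡m _ c+1≡2n _ _ =
    ⊥-elim (<-irrefl c+1≡2n (≤-<-trans (≤-trans (m≤n+m (suc c) q) (≤-reflexive (shift q+c≡m))) m<2n))
  entry-v-phase1 (suc q) {c} {suc L} q+c≡m n≤c L+c+1≡2n {x} 1≤x x≤n = begin
    entry (v (suc q)) x                  ≡⟨ entry-v-suc x q+c≡m′ label≡ (s≤s z≤n) L+1<n ⟩
    entry (v q) (transposeIf s (suc L) x) ≡⟨ entry-v-phase1 q q+c≡m′ (m≤n⇒m≤1+n n≤c) (trans (+-suc L (suc c)) L+c+1≡2n)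
                                              (transposeIf-pos s (s≤s z≤n) 1≤x) (transposeIf-≤ s x≤n L+1<n) ⟩
    + π L (transposeIf s (suc L) x)      ≡⟨ cong (λ b → + π L (transposeIf (val D b) (suc L) x)) box≡ ⟨
    + π (suc L) x                        ∎
    where
      open ≡-Reasoning
      s = val D (suc c)
      q+c≡m′ = shift q+c≡m
      L+1<n = label<n (s≤s n≤c) L+c+1≡2n
      box≡ : 2 * n ∸ suc L ≡ suc c
      box≡ = trans (cong (_∸ suc L) (sym L+c+1≡2n)) (m+n∸m≡n (suc L) (suc c))
      label≡ : label n (suc c) ≡ suc L
      label≡ = trans (label-> (s≤s n≤c)) (trans (cong (_∸ suc c) (sym L+c+1≡2n)) (m+n∸n≡m (suc L) (suc c)))

  entry-v-middle : ∀ {q} → q + n ≡ m → ∀ {x} → 1 ≤ x → x ≤ n → entry (v q) x ≡ + π (n ∸ 1) x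
  entry-v-middle {q} q+n≡m = entry-v-phase1 q q+n≡m ≤-refl (begin
    n ∸ 1 + suc n    ≡⟨ +-suc (n ∸ 1) n ⟩
    suc (n ∸ 1) + n  ≡⟨ cong (_+ n) (suc-∸1 1≤n) ⟩
    n + n            ≡⟨ 2*n≡n+n n ⟨
    2 * n            ∎)
    where open ≡-Reasoning

  π-unused-all : m < n → ∀ x → π (n ∸ 1) x ≡ x
  π-unused-all m<n x = π-unused (n ∸ 1) x λ t _ t≤n-1 → val-beyond D (m+n≤o⇒m≤o∸n (suc m) (begin
    suc m + t   ≤⟨ +-mono-≤ m<n (≤-trans t≤n-1 (m∸n≤m n 1)) ⟩
    n + n       ≡⟨ 2*n≡n+n n ⟨
    2 * n       ∎))
    where open ≤-Reasoning

  entry-v-left : ∀ q {c} → q + c ≡ m → c < n → ∀ {x} → 1 ≤ x → x ≤ c → entry (v q) x ≡ + π (n ∸ 1) x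
  entry-v-left zero {c} c≡m c<n {x} 1≤x x≤c =
    trans (entry-idn n 1≤x (≤-trans x≤c (<⇒≤ c<n))) (cong +_ (sym (π-unused-all (subst (_< n) c≡m c<n) x)))
  entry-v-left (suc q) {c} q+c≡m c<n {x} 1≤x x≤c with m≤n⇒m<n∨m≡n c<n
  ... | inj₁ c+1<n = begin
    entry (v (suc q)) x                          ≡⟨ entry-v-suc x q+c≡m′ (label-≤ c<n) (s≤s z≤n) c+1<n ⟩
    entry (v q) (transposeIf s (suc c) x)        ≡⟨ cong (entry (v q)) (transposeIf-fix-below s (s≤s x≤c)) ⟩
    entry (v q) x                                ≡⟨ entry-v-left q q+c≡m′ c+1<n 1≤x (m≤n⇒m≤1+n x≤c) ⟩
    + π (n ∸ 1) x                                ∎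
    where
      open ≡-Reasoning
      s = val D (suc c)
      q+c≡m′ = shift q+c≡m
  ... | inj₂ c+1≡n = begin
    entry (v (suc q)) x     ≡⟨ entry-v-suc-middle x q+n≡m x≢n ⟩
    entry (v q) x           ≡⟨ entry-v-middle q+n≡m 1≤x (≤-trans x≤c (<⇒≤ c<n)) ⟩
    + π (n ∸ 1) x           ∎
    where
      open ≡-Reasoning
      q+n≡m = subst (λ b → q + b ≡ m) c+1≡n (shift q+c≡m)
      x≢n : x ≢ n
      x≢n refl = 1+n≰n (≤-trans c<n x≤c)

  -- Just before b_c (c < n) is read, position c + 1 holds the entry carried down from the
  -- first box b_e above b_c that is +, or, if there is none up to b_n, the negated entry at n.
  data NextEntry (c : ℕ) (y : ℤ) : Set where
    negated : y ≡ ℤ.- + π (n ∸ 1) n → NextEntry c y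
    moved   : ∀ {e} → c < e → e ≤ n → val D e ≡ pls → y ≡ + π (n ∸ 1) e → NextEntry c y

  entry-v-next : ∀ q {c} → q + c ≡ m → c < n → NextEntry c (entry (v q) (suc c))
  entry-v-next zero {c} c≡m c<n =
    moved ≤-refl c<n (val-beyond D (≤-reflexive (cong suc (sym c≡m))))
      (trans (entry-idn n (s≤s z≤n) c<n) (cong +_ (sym (π-unused-all (subst (_< n) c≡m c<n) (suc c)))))
  entry-v-next (suc q) {c} q+c≡m c<n with m≤n⇒m<n∨m≡n c<n
  ... | inj₁ c+1<n = subst (NextEntry c) (sym (entry-v-suc (suc c) q+c≡m′ (label-≤ c<n) (s≤s z≤n) c+1<n))
                                         (read (val D (suc c)) refl)
    where
      q+c≡m′ = shift q+c≡m
      carried : ∀ {y} → entry (v q) (suc (suc c)) ≡ y → entry (v q) (transpose (suc c) (suc c)) ≡ y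
      carried = trans (cong (entry (v q)) (transpose-self (suc c)))
      read : ∀ s → val D (suc c) ≡ s → NextEntry c (entry (v q) (transposeIf s (suc c) (suc c)))
      read zer _ with entry-v-next q q+c≡m′ c+1<n
      ... | negated y≡                = negated (carried y≡)
      ... | moved c+1<e e≤n box≡+ y≡ = moved (<-trans (n<1+n c) c+1<e) e≤n box≡+ (carried y≡)
      read pls box≡+ = moved ≤-refl c<n box≡+ (entry-v-left q q+c≡m′ c+1<n (s≤s z≤n) ≤-refl)
  ... | inj₂ c+1≡n = subst (NextEntry c) (sym entry≡) (read (val D n) refl)
    where
      q+n≡m = subst (λ b → q + b ≡ m) c+1≡n (shift q+c≡m)
      entry≡ : entry (v (suc q)) (suc c) ≡ negIf (val D n) (+ π (n ∸ 1) n)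
      entry≡ = begin
        entry (v (suc q)) (suc c)               ≡⟨ cong (entry (v (suc q))) c+1≡n ⟩
        entry (v (suc q)) n                     ≡⟨ entry-v-suc-middle-self q+n≡m ⟩
        negIf (val D n) (entry (v q) n)         ≡⟨ cong (negIf (val D n)) (entry-v-middle q+n≡m 1≤n ≤-refl) ⟩
        negIf (val D n) (+ π (n ∸ 1) n)         ∎
        where open ≡-Reasoning
      read : ∀ s → val D n ≡ s → NextEntry c (negIf s (+ π (n ∸ 1) n))
      read zer _     = negated refl
      read pls box≡+ = moved (subst (c <_) c+1≡n ≤-refl) ≤-refl box≡+ refl

  -- a run of used letters s_c, …, s_{e-1} closed by a box b_e = + is the forbidden pattern at the box b_{2n+1-e}
  RunTo⇒pattern : ∀ {c e} → 1 ≤ c → c < e → e ≤ n → val D e ≡ pls → RunTo (n ∸ 1) c e →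
    ¬ AvoidsPattern n D
  RunTo⇒pattern {c} {suc e′} _ c<e e≤n box≡+ (inside , stop) avoids =
    avoids k n<k (proj₂ (val≡zer⇒box D used)) used (left≡+ , conjugate≡+)
    where
      used : Used e′
      used = proj₂ (inside e′ (≤-pred c<e) ≤-refl)
      k = 2 * n ∸ e′
      e′≤2n : e′ ≤ 2 * n
      e′≤2n = ≤-trans (<⇒≤ e≤n) (≤-trans (m≤m+n n n) (≤-reflexive (sym (2*n≡n+n n))))
      n<k : n < k
      n<k = m+n≤o⇒m≤o∸n (suc n) (begin
        suc n + e′   ≡⟨ +-suc n e′ ⟨
        n + suc e′   ≤⟨ +-monoʳ-≤ n e≤n ⟩
        n + n        ≡⟨ 2*n≡n+n n ⟨
        2 * n        ∎)
        where open ≤-Reasoning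
      k∸1≡ : k ∸ 1 ≡ 2 * n ∸ suc e′
      k∸1≡ = trans (∸-+-assoc (2 * n) e′ 1) (cong (2 * n ∸_) (+-comm e′ 1))
      left≡+ : val D (k ∸ 1) ≡ pls
      left≡+ with m≤n⇒m<n∨m≡n e≤n
      ... | inj₁ e<n = trans (cong (val D) k∸1≡) (≢zer⇒≡pls (λ used-e → stop (e≤n-1 , used-e)))
        where e≤n-1 = m+n≤o⇒m≤o∸n (suc e′) (≤-trans (≤-reflexive (+-comm (suc e′) 1)) e<n)
      ... | inj₂ e≡n = begin
        val D (k ∸ 1)            ≡⟨ cong (val D) k∸1≡ ⟩
        val D (2 * n ∸ suc e′)   ≡⟨ cong (λ b → val D (2 * n ∸ b)) e≡n ⟩
        val D (2 * n ∸ n)        ≡⟨ cong (val D) (trans (cong (_∸ n) (2*n≡n+n n)) (m+n∸m≡n n n)) ⟩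
        val D n                  ≡⟨ cong (val D) e≡n ⟨
        val D (suc e′)           ≡⟨ box≡+ ⟩
        pls                      ∎
        where open ≡-Reasoning
      conjugate≡+ : val D (2 * n ∸ k + 1) ≡ pls
      conjugate≡+ = trans (cong (λ b → val D (b + 1)) (m∸[m∸n]≡n e′≤2n)) (trans (cong (val D) (+-comm e′ 1)) box≡+)

  ascent-phase1 : ∀ {q c} → q + c ≡ m → n < c → Ascent (v q) (label n c)
  ascent-phase1 {q} {c} q+c≡m n<c = subst (Ascent (v q)) (sym label≡)
    (swap-ascent (s≤s z≤n) L+1<n (subst₂ _<_ (cong key (sym πL+1)) (cong key (sym πL+2)) (s≤s (π-≤ L ≤-refl))))
    where
      L = 2 * n ∸ suc c
      L+c+1≡2n : L + suc c ≡ 2 * n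
      L+c+1≡2n = m∸n+n≡m (≤-trans (s≤s (≤-trans (m≤n+m c q) (≤-reflexive q+c≡m))) m<2n)
      label≡ : label n c ≡ suc L
      label≡ = trans (label-> n<c) (trans (cong (_∸ c) (sym L+c+1≡2n)) (trans (cong (_∸ c) (+-suc L c)) (m+n∸n≡m (suc L) c)))
      L+1<n : suc L < n
      L+1<n = label<n n<c (trans (sym (+-suc L c)) L+c+1≡2n)
      πL+1 : entry (v q) (suc L) ≡ + π L (suc L)
      πL+1 = entry-v-phase1 q q+c≡m (<⇒≤ n<c) L+c+1≡2n (s≤s z≤n) (<⇒≤ L+1<n)
      πL+2 : entry (v q) (suc (suc L)) ≡ + suc (suc L)
      πL+2 = trans (entry-v-phase1 q q+c≡m (<⇒≤ n<c) L+c+1≡2n (s≤s z≤n) L+1<n) (cong +_ (π-fix-above L ≤-refl))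

  ascent-middle : ∀ {q} → q + n ≡ m → Ascent (v q) (label n n)
  ascent-middle {q} q+n≡m = subst (Ascent (v q)) (sym (label-≤ ≤-refl))
    (neg-ascent 1≤n (trans (entry-v-middle q+n≡m 1≤n ≤-refl) (cong +_ (sym (suc-∸1 (π-pos (n ∸ 1) 1≤n))))))

  ascent-phase3 : ∀ {q c} → AvoidsPattern n D → q + c ≡ m → 1 ≤ c → c < n → Ascent (v q) (label n c)
  ascent-phase3 {q} {c} avoids q+c≡m 1≤c c<n = subst (Ascent (v q)) (sym (label-≤ (<⇒≤ c<n)))
    (swap-ascent 1≤c c<n (subst (_< key (entry (v q) (suc c))) (cong key (sym v-at-c))
                                 (next-larger (entry-v-next q q+c≡m c<n))))
    where
      v-at-c : entry (v q) c ≡ + π (n ∸ 1) c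
      v-at-c = entry-v-left q q+c≡m c<n 1≤c ≤-refl
      πc≤n : π (n ∸ 1) c ≤ n
      πc≤n = π-bounded (n ∸ 1) (<⇒≤ c<n) (≤-reflexive (suc-∸1 1≤n))
      next-larger : ∀ {y} → NextEntry c y → π (n ∸ 1) c < key y
      next-larger (negated refl) =
        <-≤-trans (s≤s πc≤n) (neg-key-large (π-pos (n ∸ 1) 1≤n) (π-bounded (n ∸ 1) ≤-refl (≤-reflexive (suc-∸1 1≤n))))
        where
          neg-key-large : ∀ {a} → 1 ≤ a → a ≤ n → suc n ≤ key (ℤ.- + a)
          neg-key-large {suc a} _ a<n = m+n≤o⇒m≤o∸n (suc n) (begin
            suc n + a    ≡⟨ +-suc n a ⟨
            n + suc a    ≤⟨ +-monoʳ-≤ n a<n ⟩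
            n + n        ≡⟨ 2*n≡n+n n ⟨
            2 * n        ∎)
            where open ≤-Reasoning
      next-larger (moved {e} c<e e≤n box≡+ refl) with π (n ∸ 1) e ≤? π (n ∸ 1) c
      ... | yes πe≤πc = ⊥-elim (RunTo⇒pattern 1≤c c<e e≤n box≡+ (π-inversion (n ∸ 1) c<e πe≤πc) avoids)
      ... | no  πe≰πc = ≰⇒> πe≰πc

  ascent-v : ∀ {q c} → AvoidsPattern n D → q + c ≡ m → 1 ≤ c → Ascent (v q) (label n c)
  ascent-v {q} {c} avoids q+c≡m 1≤c with <-cmp c n
  ... | tri< c<n _ _ = ascent-phase3 avoids q+c≡m 1≤c c<n
  ... | tri≈ _ refl _ = ascent-middle q+c≡m
  ... | tri> _ _ n<c = ascent-phase1 q+c≡m n<c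

  q+[m∸q]≡m : ∀ {q} → q < m → q + (m ∸ q) ≡ m
  q+[m∸q]≡m q<m = m+[n∸m]≡n (<⇒≤ q<m)

  inversions-v-next : AvoidsPattern n D → ∀ {q} → q < m →
    inversions (mulGen n (v q) (label n (m ∸ q))) ≡ suc (inversions (v q))
  inversions-v-next avoids {q} q<m =
    inversions-mulGen-ascent (WellFormed-v q) (ascent-v avoids (q+[m∸q]≡m q<m) (m<n⇒0<n∸m q<m))

  inversions-v : AvoidsPattern n D → ∀ q → q ≤ m → inversions (v q) ≡ len q
  inversions-v avoids zero    _   = inversions-idn
  inversions-v avoids (suc q) q<m = begin
    inversions (v (suc q))                           ≡⟨ cong inversions (v-suc (q+[m∸q]≡m q<m)) ⟩
    inversions (mulIf n (val D c) (label n c) (v q)) ≡⟨ by-box (val D c) ⟩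
    sucIf (val D c) (len q)                          ≡⟨ len-suc (q+[m∸q]≡m q<m) ⟨
    len (suc q)                                      ∎
    where
      open ≡-Reasoning
      c = m ∸ q
      by-box : ∀ s → inversions (mulIf n s (label n c) (v q)) ≡ sucIf s (len q)
      by-box zer = trans (inversions-v-next avoids {q} q<m) (cong suc (inversions-v avoids q (<⇒≤ q<m)))
      by-box pls = inversions-v avoids q (<⇒≤ q<m)

  isLength-v : AvoidsPattern n D → ∀ q → q ≤ m → IsLength n (v q) (len q)
  isLength-v avoids q q≤m = isLength-eval (valid q) (inversions-v avoids q q≤m)

  isLength-v-next : AvoidsPattern n D → ∀ q → q < m → IsLength n (mulGen n (v q) (label n (m ∸ q))) (suc (len q))
  isLength-v-next avoids q q<m = subst₂ (IsLength n) (eval-snoc n (vWord n D q) l) length-snoc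
    (isLength-eval (++⁺ (valid q) (label-range (m<n⇒0<n∸m q<m) (m∸n≤m m q) ∷ [])) (begin
      inversions (eval n (vWord n D q ++ l ∷ []))  ≡⟨ cong inversions (eval-snoc n (vWord n D q) l) ⟩
      inversions (mulGen n (v q) l)                ≡⟨ inversions-v-next avoids {q} q<m ⟩
      suc (inversions (v q))                       ≡⟨ cong suc (inversions-v avoids q (<⇒≤ q<m)) ⟩
      suc (len q)                                  ≡⟨ length-snoc ⟨
      length (vWord n D q ++ l ∷ [])               ∎))
    where
      open ≡-Reasoning
      l = label n (m ∸ q)
      length-snoc : length (vWord n D q ++ l ∷ []) ≡ suc (len q)
      length-snoc = trans (length-++ (vWord n D q)) (+-comm (len q) 1)

  iLetter≡label : ∀ q → iLetter n m (suc q) ≡ label n (m ∸ q)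
  iLetter≡label q = cong (λ z → label n (z ∸ suc q)) (+-comm m 1)

  avoids⇒Γ : AvoidsPattern n D → IsΓDiagram n D
  avoids⇒Γ avoids (suc q) _ q<m rewrite iLetter≡label q =
    step (([] , label n (m ∸ q) , [] , label-range (m<n⇒0<n∸m q<m) (m∸n≤m m q) , refl) ,
          (len q , suc (len q) , isLength-v avoids q (<⇒≤ q<m) , isLength-v-next avoids q q<m , ≤-refl))

  Γ-at : IsΓDiagram n D → ∀ {q} → q < m → BruhatLt n (v q) (mulGen n (v q) (label n (m ∸ q)))
  Γ-at Γ {q} q<m = subst (λ l → BruhatLt n (v q) (act n (v q) (l ∷ []))) (iLetter≡label q) (Γ (suc q) (s≤s z≤n) q<m)

  -- along a Γ-diagram every used letter is a length-increasing step
  Γ⇒len≤length : IsΓDiagram n D → ∀ q → q ≤ m → ∀ {a} → IsLength n (v q) a → len q ≤ a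
  Γ⇒len≤length Γ zero    _   _  = z≤n
  Γ⇒len≤length Γ (suc q) q<m {a} la with BruhatLt-length< (Γ-at Γ q<m)
  ... | a′ , b′ , la′ , lb′ , a′<b′ =
    subst (_≤ a) (sym (len-suc q+c≡m)) (by-box (val D c) (subst (λ w → IsLength n w a) (v-suc q+c≡m) la))
    where
      c = m ∸ q
      q+c≡m = q+[m∸q]≡m q<m
      len≤a′ = Γ⇒len≤length Γ q (<⇒≤ q<m) la′
      by-box : ∀ s → IsLength n (mulIf n s (label n c) (v q)) a → sucIf s (len q) ≤ a
      by-box zer lb = subst (suc (len q) ≤_) (isLength-unique lb′ lb) (≤-<-trans len≤a′ a′<b′)
      by-box pls la″ = subst (len q ≤_) (isLength-unique la′ la″) len≤a′

-- A forbidden pattern obstructs the Γ-property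

module ForbiddenPattern (n : ℕ) (1≤n : 1 ≤ n) (m : ℕ) (m<2n : m < 2 * n) (D : Vec Sign m)
  (k : ℕ) (n<k : n < k) (k≤m : k ≤ m) (box≡0 : val D k ≡ zer)
  (left≡+ : val D (k ∸ 1) ≡ pls) (conjugate≡+ : val D (2 * n ∸ k + 1) ≡ pls) where

  D⁺ : Vec Sign m
  D⁺ = markPlus D k

  open Diagram n 1≤n m m<2n D
  module D′ = Diagram n 1≤n m m<2n D⁺

  j : ℕ
  j = 2 * n ∸ k

  j+k≡2n : j + k ≡ 2 * n
  j+k≡2n = m∸n+n≡m (≤-trans k≤m (<⇒≤ m<2n))

  1≤j : 1 ≤ j
  1≤j = m<n⇒0<n∸m (≤-<-trans k≤m m<2n)

  j<n : j < n
  j<n = label<n n<k j+k≡2n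

  j<k : j < k
  j<k = <-trans j<n n<k

  box-j+1≡+ : val D (suc j) ≡ pls
  box-j+1≡+ = trans (cong (val D) (+-comm 1 j)) conjugate≡+

  markPlus-agrees : ∀ q {c} → q + c ≡ m → k ≤ c → D′.v q ≡ v q × D′.len q ≡ len q
  markPlus-agrees zero    _     _   = refl , refl
  markPlus-agrees (suc q) {c} q+c≡m k≤c = by-box (val D (suc c)) refl
    where
      q+c≡m′ = shift q+c≡m
      agree = markPlus-agrees q q+c≡m′ (m≤n⇒m≤1+n k≤c)
      same-box : val D⁺ (suc c) ≡ val D (suc c)
      same-box = val-markPlus-other D k (λ c+1≡k → <-irrefl (sym c+1≡k) (s≤s k≤c))
      by-box : ∀ s → val D (suc c) ≡ s → D′.v (suc q) ≡ v (suc q) × D′.len (suc q) ≡ len (suc q)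
      by-box zer box =
        let (v≡ , len≡) = read-zer q+c≡m′ box; (v′≡ , len′≡) = D′.read-zer q+c≡m′ (trans same-box box) in
        trans v′≡ (trans (cong (λ w → mulGen n w (label n (suc c))) (proj₁ agree)) (sym v≡)) ,
        trans len′≡ (trans (cong suc (proj₂ agree)) (sym len≡))
      by-box pls box =
        let (v≡ , len≡) = read-pls q+c≡m′ box; (v′≡ , len′≡) = D′.read-pls q+c≡m′ (trans same-box box) in
        trans v′≡ (trans (proj₁ agree) (sym v≡)) , trans len′≡ (trans (proj₂ agree) (sym len≡))

  label-between : ∀ {c} → val D (suc c) ≡ zer → j ≤ c → suc c < k →
    suc (suc j) ≤ label n (suc c) × label n (suc c) ≤ n
  label-between {c} box≡0′ j≤c c+1<k = lower , proj₂ (label-range (s≤s z≤n) (proj₂ (val≡zer⇒box D box≡0′)))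
    where
      j+2≤c+1 : suc (suc j) ≤ suc c
      j+2≤c+1 = ≤∧≢⇒< (s≤s j≤c) λ j+1≡c+1 →
        case trans (sym box≡0′) (trans (cong (val D) (sym j+1≡c+1)) box-j+1≡+) of λ ()
      c+3≤k : suc (suc (suc c)) ≤ k
      c+3≤k = ≤∧≢⇒< c+1<k λ c+2≡k →
        case trans (sym box≡0′) (trans (cong (λ b → val D (b ∸ 1)) c+2≡k) left≡+) of λ ()
      lower : suc (suc j) ≤ label n (suc c)
      shuffle : ∀ j c → suc (suc j) + suc c ≡ j + suc (suc (suc c))
      shuffle = solve-∀
      j+2+c+1≤2n : suc (suc j) + suc c ≤ 2 * n
      j+2+c+1≤2n = begin
        suc (suc j) + suc c       ≡⟨ shuffle j c ⟩
        j + suc (suc (suc c))     ≤⟨ +-monoʳ-≤ j c+3≤k ⟩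
        j + k                     ≡⟨ j+k≡2n ⟩
        2 * n                     ∎
        where open ≤-Reasoning
      lower = case suc c ≤? n of λ where
        (yes c+1≤n) → subst (suc (suc j) ≤_) (sym (label-≤ c+1≤n)) j+2≤c+1
        (no  c+1≰n) → subst (suc (suc j) ≤_) (sym (label-> (≰⇒> c+1≰n))) (m+n≤o⇒m≤o∸n (suc (suc j)) j+2+c+1≤2n)

  Commuted : ℕ → Set
  Commuted q = mulGen n (v q) j ≡ D′.v q × len q ≡ suc (D′.len q)

  commuted-at-k : ∀ {q c} → q + suc c ≡ m → suc c ≡ k → Commuted (suc q)
  commuted-at-k {q} {c} q+c≡m c+1≡k =
    (begin
      mulGen n (v (suc q)) j                  ≡⟨ cong (λ w → mulGen n w j) (proj₁ read-b-k) ⟩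
      mulGen n (mulGen n (v q) (label n (suc c))) j ≡⟨ cong (λ l → mulGen n (mulGen n (v q) l) j) label≡j ⟩
      mulGen n (mulGen n (v q) j) j           ≡⟨ mulGen-involutive (v q) 1≤j j<n ⟩
      v q                                     ≡⟨ proj₁ agree ⟨
      D′.v q                                  ≡⟨ proj₁ read-b-k⁺ ⟨
      D′.v (suc q)                            ∎) ,
    trans (proj₂ read-b-k) (cong suc (trans (sym (proj₂ agree)) (sym (proj₂ read-b-k⁺))))
    where
      open ≡-Reasoning
      agree = markPlus-agrees q q+c≡m (≤-reflexive (sym c+1≡k))
      read-b-k = read-zer q+c≡m (subst (λ b → val D b ≡ zer) (sym c+1≡k) box≡0)
      read-b-k⁺ = D′.read-pls q+c≡m (subst (λ b → val D⁺ b ≡ pls) (sym c+1≡k) (val-markPlus-self D k))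
      label≡j : label n (suc c) ≡ j
      label≡j = trans (cong (label n) c+1≡k) (label-> n<k)

  commuted-past : ∀ {q c} → q + suc c ≡ m → j ≤ c → suc c < k → Commuted q → Commuted (suc q)
  commuted-past {q} {c} q+c≡m j≤c c+1<k (v·j≡v′ , len≡) = by-box (val D (suc c)) refl
    where
      open ≡-Reasoning
      l = label n (suc c)
      same-box : val D⁺ (suc c) ≡ val D (suc c)
      same-box = val-markPlus-other D k (λ c+1≡k → <-irrefl c+1≡k c+1<k)
      by-box : ∀ s → val D (suc c) ≡ s → Commuted (suc q)
      by-box zer box =
        let (v≡ , len-suc≡) = read-zer q+c≡m box; (v′≡ , len′-suc≡) = D′.read-zer q+c≡m (trans same-box box)
            range = label-between box j≤c c+1<k in
        (begin
          mulGen n (v (suc q)) j          ≡⟨ cong (λ w → mulGen n w j) v≡ ⟩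
          mulGen n (mulGen n (v q) l) j   ≡⟨ mulGen-comm (v q) 1≤j (proj₁ range) (proj₂ range) ⟩
          mulGen n (mulGen n (v q) j) l   ≡⟨ cong (λ w → mulGen n w l) v·j≡v′ ⟩
          mulGen n (D′.v q) l             ≡⟨ v′≡ ⟨
          D′.v (suc q)                    ∎) ,
        trans len-suc≡ (cong suc (trans len≡ (sym len′-suc≡)))
      by-box pls box =
        let (v≡ , len-suc≡) = read-pls q+c≡m box; (v′≡ , len′-suc≡) = D′.read-pls q+c≡m (trans same-box box) in
        trans (cong (λ w → mulGen n w j) v≡) (trans v·j≡v′ (sym v′≡)) ,
        trans len-suc≡ (trans len≡ (cong suc (sym len′-suc≡)))

  commuted : ∀ q {c} → q + c ≡ m → j ≤ c → c < k → Commuted q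
  commuted zero    {c} c≡m _ c<k = ⊥-elim (<-irrefl c≡m (<-≤-trans c<k k≤m))
  commuted (suc q) {c} q+c≡m j≤c c<k with m≤n⇒m<n∨m≡n c<k
  ... | inj₂ c+1≡k = commuted-at-k (shift q+c≡m) c+1≡k
  ... | inj₁ c+1<k = commuted-past (shift q+c≡m) j≤c c+1<k (commuted q (shift q+c≡m) (m≤n⇒m≤1+n j≤c) c+1<k)

  qⱼ : ℕ
  qⱼ = m ∸ j

  j≤m : j ≤ m
  j≤m = <⇒≤ (<-≤-trans j<k k≤m)

  qⱼ+j≡m : qⱼ + j ≡ m
  qⱼ+j≡m = m∸n+n≡m j≤m

  qⱼ<m : qⱼ < m
  qⱼ<m = ≤-trans (≤-reflexive (+-comm 1 qⱼ)) (≤-trans (+-monoʳ-≤ qⱼ 1≤j) (≤-reflexive qⱼ+j≡m))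

  Γ-at-j : IsΓDiagram n D → BruhatLt n (v qⱼ) (mulGen n (v qⱼ) j)
  Γ-at-j Γ = subst (λ l → BruhatLt n (v qⱼ) (mulGen n (v qⱼ) l))
    (trans (cong (label n) (m∸[m∸n]≡n j≤m)) (label-≤ (<⇒≤ j<n))) (Γ-at Γ qⱼ<m)

  ¬Γ : ¬ IsΓDiagram n D
  ¬Γ Γ with BruhatLt-length< (Γ-at-j Γ)
  ... | a , b , la , lb , a<b = <-irrefl refl (begin-strict
    D′.len qⱼ   <⟨ ≤-reflexive (sym (proj₂ commuted-j)) ⟩
    len qⱼ      ≤⟨ Γ⇒len≤length Γ qⱼ (<⇒≤ qⱼ<m) la ⟩
    a           <⟨ a<b ⟩
    b           ≤⟨ proj₂ lb (vWord n D⁺ qⱼ) (D′.valid qⱼ) (sym (proj₁ commuted-j)) ⟩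
    D′.len qⱼ   ∎)
    where
      open ≤-Reasoning
      commuted-j = commuted qⱼ qⱼ+j≡m ≤-refl j<k

Γ⇒avoids : ∀ n → 1 ≤ n → ∀ m → m < 2 * n → (D : Vec Sign m) → IsΓDiagram n D → AvoidsPattern n D
Γ⇒avoids n 1≤n m m<2n D Γ k n<k k≤m box≡0 (left≡+ , conjugate≡+) =
  ForbiddenPattern.¬Γ n 1≤n m m<2n D k n<k k≤m box≡0 left≡+ conjugate≡+ Γ

mainTheorem7 : (n : ℕ) → 2 ≤ n → (m : ℕ) → m ≤ 2 * n ∸ 1 → (D : Vec Sign m) →
    IsΓDiagram n D ⇔
      (∀ k → n < k → k ≤ m → val D k ≡ zer →
        ¬ (val D (k ∸ 1) ≡ pls × val D (2 * n ∸ k + 1) ≡ pls))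
mainTheorem7 n 2≤n m m≤2n-1 D = mk⇔ (Γ⇒avoids n 1≤n m m<2n D) (Diagram.avoids⇒Γ n 1≤n m m<2n D)
  where
    1≤n = ≤-trans (s≤s z≤n) 2≤n
    m<2n = ≤-trans (s≤s m≤2n-1) (≤-reflexive (suc-∸1 (≤-trans 1≤n (m≤m+n n (n + 0)))))
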